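{- Let $n\ge2$, $w\in\mathcal S_n$, and let $a\in\mathrm{R}(w)$ with $a\notin[a_{\min}]$. Then there exists $b\in\mathrm{R}(w)$ such that the classes $[b]$ and $[a]$ differ by a single long braid relation (i.e. there exist $a'\in[a]$, $b'\in[b]$ differing by a single long braid relation) and $\mathrm{sup}(b)\subsetneq\mathrm{sup}(a)$.
   Context: Applying a letter $i\in\{1,\dots,n-1\}$ to a word of length $n$ swaps its entries in positions $i$ and $i+1$. The length $\ell(w)$ is the number of inversions of $w$ (pairs of values $p>q$ with $p$ before $q$ in $w$). A reduced word of $w$ is a word $a=a_1\cdots a_{\ell(w)}$ over $\{1,\dots,n-1\}$ such that applying successively $a_1,\dots,a_{\ell(w)}$ to the identity word $12\cdots n$ yields $w$; $\mathrm{R}(w)$ is the set of reduced words. In this process each letter $a_j$ swaps two adjacent values $q<p$, each inversion pair $(p,q)$ of $w$ being swapped by exactly one letter; the canonical labelling is $P_a(p,q)=j$ iff $a_j$ swaps $p$ and $q$. Two reduced words differ by a commutation if one is obtained from the other by replacing a factor $ij$ with $|i-j|\ge2$ by $ji$; they differ by a long braid relation if one is obtained from the other by replacing a factor $i(i+1)i$ by $(i+1)i(i+1)$ or vice versa. $[a]$ is the commutation class of $a$ (class under sequences of commutations). $\mathrm{T}_w$ is the set of triples $(x,y,z)$ with $x<y<z$ such that $z$ appears before $y$ and $y$ before $x$ in $w$; $\Gamma(a,(x,y,z))=1$ if $P_a(y,x)>P_a(z,y)$ and $0$ otherwise; $\mathrm{sup}(a)=\{\tau\in\mathrm{T}_w:\Gamma(a,\tau)=1\}$.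 The word $a_{\min}$: set $w^0=w$ and, while $w^j$ is not the identity, let $i_j$ be the smallest descent of $w^j$ (an index $i$ with $w^j_i>w^j_{i+1}$) and let $w^{j+1}$ be $w^j$ with the entries in positions $i_j,i_j+1$ swapped; then $a_{\min}=i_{\ell(w)-1}\cdots i_1i_0$. -}

module Defs where

open import Data.Nat using (ℕ; zero; suc; _+_; _∸_; _≤_; _<_; _≟_; _<ᵇ_)
open import Data.Bool using (Bool; true; false; if_then_else_; _∧_; _∨_)
open import Data.List using (List; []; _∷_; _++_; length; reverse; upTo; map; filter)
open import Data.Maybe using (Maybe; just; nothing)
open import Data.Product using (_×_; _,_; ∃; ∃-syntax; Σ-syntax)
open import Data.Sum using (_⊎_)
open import Relation.Nullary using (¬_)
open import Relation.Nullary.Decidable using (⌊_⌋)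
open import Relation.Binary.PropositionalEquality using (_≡_)
open import Relation.Binary.Construct.Closure.ReflexiveTransitive using (Star)
open import Data.List.Relation.Binary.Permutation.Propositional using (_↭_)

-- Words and permutations are lists of naturals; permutations of [n] are in
-- one-line notation with values 1..n; positions are 1-indexed.

idPerm : ℕ → List ℕ
idPerm n = map suc (upTo n)

IsPerm : ℕ → List ℕ → Set
IsPerm n w = w ↭ idPerm n

swapAt : ℕ → List ℕ → List ℕ
swapAt zero xs = xs
swapAt (suc zero) [] = []
swapAt (suc zero) (x ∷ []) = x ∷ []
swapAt (suc zero) (x ∷ y ∷ xs) = y ∷ x ∷ xs
swapAt (suc (suc i)) [] = []
swapAt (suc (suc i)) (x ∷ xs) = x ∷ swapAt (suc i) xs

applyWord : List ℕ → List ℕ → List ℕ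
applyWord cur [] = cur
applyWord cur (i ∷ as) = applyWord (swapAt i cur) as

countLess : ℕ → List ℕ → ℕ
countLess x [] = 0
countLess x (y ∷ ys) = (if y <ᵇ x then 1 else 0) + countLess x ys

inv : List ℕ → ℕ
inv [] = 0
inv (x ∷ xs) = countLess x xs + inv xs

AllLetters : ℕ → List ℕ → Set
AllLetters n [] = Data.Unit.⊤ where import Data.Unit
AllLetters n (i ∷ as) = (1 ≤ i × i ≤ n ∸ 1) × AllLetters n as

Reduced : ℕ → List ℕ → List ℕ → Set
Reduced n w a = AllLetters n a × length a ≡ inv w × applyWord (idPerm n) a ≡ w

-- entry in position i (1-indexed), 0 if out of range
nth : ℕ → List ℕ → ℕ
nth _ [] = 0
nth zero (x ∷ xs) = 0
nth (suc zero) (x ∷ xs) = x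
nth (suc (suc i)) (x ∷ xs) = nth (suc i) xs

swaps : List ℕ → List ℕ → List (ℕ × ℕ)
swaps cur [] = []
swaps cur (i ∷ as) = (nth i cur , nth (suc i) cur) ∷ swaps (swapAt i cur) as

eqb : ℕ → ℕ → Bool
eqb m k = ⌊ m ≟ k ⌋

-- index (1-based) of the first swap exchanging the values p and q; 0 if none
labelFrom : ℕ → List (ℕ × ℕ) → ℕ → ℕ → ℕ
labelFrom j [] p q = 0
labelFrom j ((u , v) ∷ ps) p q =
  if (eqb u p ∧ eqb v q) ∨ (eqb u q ∧ eqb v p) then j else labelFrom (suc j) ps p q

P : ℕ → List ℕ → ℕ → ℕ → ℕ
P n a p q = labelFrom 1 (swaps (idPerm n) a) p q

-- position (1-based) of value v in w (length w + 1 if absent)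
posOf : ℕ → List ℕ → ℕ
posOf v [] = 1
posOf v (x ∷ xs) = if eqb x v then 1 else suc (posOf v xs)

InT : ℕ → List ℕ → ℕ × ℕ × ℕ → Set
InT n w (x , y , z) =
  1 ≤ x × x < y × y < z × z ≤ n × posOf z w < posOf y w × posOf y w < posOf x w

-- τ ∈ sup(a), i.e. τ ∈ T_w and Γ(a,τ) = 1
InSup : ℕ → List ℕ → List ℕ → ℕ × ℕ × ℕ → Set
InSup n w a (x , y , z) = InT n w (x , y , z) × P n a z y < P n a y x

Commutation : List ℕ → List ℕ → Set
Commutation a b = ∃[ u ] ∃[ v ] ∃[ i ] ∃[ j ]
  ((2 + i ≤ j) ⊎ (2 + j ≤ i)) × a ≡ u ++ i ∷ j ∷ v × b ≡ u ++ j ∷ i ∷ v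

SameClass : List ℕ → List ℕ → Set
SameClass a b = Star Commutation a b

LongBraid : List ℕ → List ℕ → Set
LongBraid a b = ∃[ u ] ∃[ v ] ∃[ i ]
  ((a ≡ u ++ i ∷ suc i ∷ i ∷ v × b ≡ u ++ suc i ∷ i ∷ suc i ∷ v)
   ⊎ (a ≡ u ++ suc i ∷ i ∷ suc i ∷ v × b ≡ u ++ i ∷ suc i ∷ i ∷ v))

sucM : Maybe ℕ → Maybe ℕ
sucM (just i) = just (suc i)
sucM nothing = nothing

firstDescentFrom : ℕ → List ℕ → Maybe ℕ
firstDescentFrom x [] = nothing
firstDescentFrom x (y ∷ xs) = if y <ᵇ x then just 1 else sucM (firstDescentFrom y xs)

firstDescent : List ℕ → Maybe ℕ
firstDescent [] = nothing
firstDescent (x ∷ xs) = firstDescentFrom x xs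

minSeq : ℕ → List ℕ → List ℕ
minSeq zero w = []
minSeq (suc k) w with firstDescent w
... | nothing = []
... | just i = i ∷ minSeq k (swapAt i w)

-- a_min = i_{ℓ-1} ... i_1 i_0  (fuel ℓ(w) suffices)
amin : List ℕ → List ℕ
amin w = reverse (minSeq (inv w) w)

{-# OPTIONS --safe #-}
module Submission where

-- Both a_min and the following exchange argument strip leftmost descents: if j is a record
-- (e.g. the leftmost) descent of w, a reduced word of w either commutes to a word ending in j,
-- or its commutation class contains a word with a factor (i+1) i (i+1). Iterating, a ∉ [a_min]
-- yields such an a′ ∈ [a]; b replaces the factor by i (i+1) i. The labels of b are those of a′
-- composed with the reflection s ↔ s+2 of the three braid positions, which cannot create a
-- triple with P(z,y) < P(y,x), so sup(b) ⊆ sup(a′) = sup(a) (sup is constant on commutation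
-- classes, since a commutation acts on labels by an adjacent transposition). The three values
-- α < β < γ exchanged by the braid form a triple of sup(a′) that is not in sup(b).

open import Defs
open import Data.Bool using (Bool; true; false; T; _∧_; _∨_; if_then_else_)
open import Data.Empty using (⊥; ⊥-elim)
open import Data.List using (List; []; _∷_; _++_; _∷ʳ_; length; reverse; map; applyUpTo)
open import Data.List.Properties using (++-assoc; length-++; unfold-reverse)
open import Data.List.Relation.Unary.All using (All; []; _∷_)
import Data.List.Relation.Unary.All as All
open import Data.Maybe using (just; nothing)
open import Data.Nat
open import Data.Nat.Properties
open import Data.Product using (_×_; _,_; proj₁; proj₂; ∃-syntax)
open import Data.Sum using (_⊎_; inj₁; inj₂; [_,_]′) renaming (map to map⊎)
open import Data.List.Reverse using (reverseView; []; _∶_∶ʳ_)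
open import Data.Unit using (⊤; tt)
open import Function using (_∘′_)
open import Algebra.Properties.CommutativeSemigroup +-commutativeSemigroup using (x∙yz≈y∙xz)
open import Data.Nat.Solver using (module +-*-Solver)
open +-*-Solver using (solve; _:+_; _:=_)
open import Relation.Binary.Construct.Closure.ReflexiveTransitive using (ε; _◅_; _◅◅_)
import Relation.Binary.Construct.Closure.ReflexiveTransitive as Star
open import Relation.Binary.Definitions using (tri<; tri≈; tri>)
open import Relation.Binary.PropositionalEquality
open import Relation.Nullary using (¬_; yes; no)
open import Relation.Nullary.Decidable using (toWitness)

-- Transpositions of positions

transpose : ℕ → ℕ → ℕ → ℕ
transpose a b m with m ≟ a
... | yes _ = b
... | no _ with m ≟ b
...   | yes _ = a
...   | no _ = m

transpose-cases : ∀ a b m →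
  (m ≡ a × transpose a b m ≡ b) ⊎ (m ≢ a × m ≡ b × transpose a b m ≡ a) ⊎
  (m ≢ a × m ≢ b × transpose a b m ≡ m)
transpose-cases a b m with m ≟ a
... | yes m≡a = inj₁ (m≡a , refl)
... | no m≢a with m ≟ b
...   | yes m≡b = inj₂ (inj₁ (m≢a , m≡b , refl))
...   | no m≢b = inj₂ (inj₂ (m≢a , m≢b , refl))

transpose-applyˡ : ∀ a b → transpose a b a ≡ b
transpose-applyˡ a b with transpose-cases a b a
... | inj₁ (_ , e) = e
... | inj₂ (inj₁ (a≢a , _)) = ⊥-elim (a≢a refl)
... | inj₂ (inj₂ (a≢a , _)) = ⊥-elim (a≢a refl)

transpose-applyʳ : ∀ a b → b ≢ a → transpose a b b ≡ a
transpose-applyʳ a b b≢a with transpose-cases a b b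
... | inj₁ (b≡a , _) = ⊥-elim (b≢a b≡a)
... | inj₂ (inj₁ (_ , _ , e)) = e
... | inj₂ (inj₂ (_ , b≢b , _)) = ⊥-elim (b≢b refl)

transpose-fix : ∀ a b m → m ≢ a → m ≢ b → transpose a b m ≡ m
transpose-fix a b m m≢a m≢b with transpose-cases a b m
... | inj₁ (m≡a , _) = ⊥-elim (m≢a m≡a)
... | inj₂ (inj₁ (_ , m≡b , _)) = ⊥-elim (m≢b m≡b)
... | inj₂ (inj₂ (_ , _ , e)) = e

transpose-involutive : ∀ a b m → transpose a b (transpose a b m) ≡ m
transpose-involutive a b m with transpose-cases a b m
... | inj₁ (refl , e) with b ≟ m
...   | yes refl = trans (cong (transpose b b) e) e
...   | no b≢a = trans (cong (transpose m b) e) (transpose-applyʳ m b b≢a)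
transpose-involutive a b m | inj₂ (inj₁ (_ , refl , e)) = trans (cong (transpose a m) e) (transpose-applyˡ a m)
transpose-involutive a b m | inj₂ (inj₂ (_ , _ , e)) = trans (cong (transpose a b) e) e

transpose-suc-mono : ∀ k m m′ → m < m′ → ¬ (m ≡ k × m′ ≡ suc k) →
  transpose k (suc k) m < transpose k (suc k) m′
transpose-suc-mono k m m′ m<m′ not-k with transpose-cases k (suc k) m | transpose-cases k (suc k) m′
... | inj₁ (refl , _) | inj₁ (refl , _) = ⊥-elim (<-irrefl refl m<m′)
... | inj₁ (refl , _) | inj₂ (inj₁ (_ , refl , _)) = ⊥-elim (not-k (refl , refl))
... | inj₁ (refl , e) | inj₂ (inj₂ (_ , m′≢sk , e′)) rewrite e | e′ = ≤∧≢⇒< m<m′ (≢-sym m′≢sk)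
... | inj₂ (inj₁ (_ , refl , _)) | inj₁ (refl , _) = ⊥-elim (<-asym m<m′ (n<1+n k))
... | inj₂ (inj₁ (_ , refl , _)) | inj₂ (inj₁ (_ , refl , _)) = ⊥-elim (<-irrefl refl m<m′)
... | inj₂ (inj₁ (_ , refl , e)) | inj₂ (inj₂ (_ , _ , e′)) rewrite e | e′ = <-trans (n<1+n k) m<m′
... | inj₂ (inj₂ (_ , _ , e)) | inj₁ (refl , e′) rewrite e | e′ = <-trans m<m′ (n<1+n k)
... | inj₂ (inj₂ (m≢k , _ , e)) | inj₂ (inj₁ (_ , refl , e′)) rewrite e | e′ = ≤∧≢⇒< (≤-pred m<m′) m≢k
... | inj₂ (inj₂ (_ , _ , e)) | inj₂ (inj₂ (_ , _ , e′)) rewrite e | e′ = m<m′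

transpose-2+-reflects-< : ∀ s f₁ f₂ →
  transpose s (2 + s) f₁ < transpose s (2 + s) f₂ →
  f₁ < f₂ ⊎ (f₁ ≡ 1 + s × f₂ ≡ s) ⊎ (f₁ ≡ 2 + s × f₂ ≡ s) ⊎ (f₁ ≡ 2 + s × f₂ ≡ 1 + s)
transpose-2+-reflects-< s f₁ f₂ lt with transpose-cases s (2 + s) f₁ | transpose-cases s (2 + s) f₂
... | inj₁ (refl , _) | inj₁ (refl , _) = ⊥-elim (<-irrefl refl lt)
... | inj₁ (refl , e₁) | inj₂ (inj₁ (_ , refl , e₂)) rewrite e₁ | e₂ = ⊥-elim (<-asym lt (m<n⇒m<1+n (n<1+n s)))
... | inj₁ (refl , e₁) | inj₂ (inj₂ (_ , _ , e₂)) rewrite e₁ | e₂ = inj₁ (<-trans (m<n⇒m<1+n (n<1+n s)) lt)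
... | inj₂ (inj₁ (_ , refl , _)) | inj₁ (refl , _) = inj₂ (inj₂ (inj₁ (refl , refl)))
... | inj₂ (inj₁ (_ , refl , _)) | inj₂ (inj₁ (_ , refl , _)) = ⊥-elim (<-irrefl refl lt)
... | inj₂ (inj₁ (_ , refl , e₁)) | inj₂ (inj₂ (_ , f₂≢2+s , e₂)) rewrite e₁ | e₂ with m≤n⇒m<n∨m≡n lt
...   | inj₂ refl = inj₂ (inj₂ (inj₂ (refl , refl)))
...   | inj₁ 1+s<f₂ = inj₁ (≤∧≢⇒< 1+s<f₂ (≢-sym f₂≢2+s))
transpose-2+-reflects-< s f₁ f₂ lt | inj₂ (inj₂ (f₁≢s , _ , e₁)) | inj₁ (refl , e₂) rewrite e₁ | e₂
  with m≤n⇒m<n∨m≡n (≤-pred lt)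
... | inj₂ refl = inj₂ (inj₁ (refl , refl))
... | inj₁ f₁<1+s = inj₁ (≤∧≢⇒< (≤-pred f₁<1+s) f₁≢s)
transpose-2+-reflects-< s f₁ f₂ lt | inj₂ (inj₂ (_ , _ , e₁)) | inj₂ (inj₁ (_ , refl , e₂)) rewrite e₁ | e₂ =
  inj₁ (<-trans lt (m<n⇒m<1+n (n<1+n s)))
transpose-2+-reflects-< s f₁ f₂ lt | inj₂ (inj₂ (_ , _ , e₁)) | inj₂ (inj₂ (_ , _ , e₂)) rewrite e₁ | e₂ = inj₁ lt

-- Words and commutation classes

length-swapAt : ∀ k c → length (swapAt k c) ≡ length c
length-swapAt zero c = refl
length-swapAt (suc zero) [] = refl
length-swapAt (suc zero) (x ∷ []) = refl
length-swapAt (suc zero) (x ∷ y ∷ c) = refl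
length-swapAt (suc (suc k)) [] = refl
length-swapAt (suc (suc k)) (x ∷ c) = cong suc (length-swapAt (suc k) c)

swapAt-involutive : ∀ k c → swapAt k (swapAt k c) ≡ c
swapAt-involutive zero c = refl
swapAt-involutive (suc zero) [] = refl
swapAt-involutive (suc zero) (x ∷ []) = refl
swapAt-involutive (suc zero) (x ∷ y ∷ c) = refl
swapAt-involutive (suc (suc k)) [] = refl
swapAt-involutive (suc (suc k)) (x ∷ c) = cong (x ∷_) (swapAt-involutive (suc k) c)

swapAt-beyond : ∀ k c → length c ≤ k → swapAt k c ≡ c
swapAt-beyond zero c _ = refl
swapAt-beyond (suc zero) [] _ = refl
swapAt-beyond (suc zero) (x ∷ []) _ = refl
swapAt-beyond (suc zero) (x ∷ y ∷ c) (s≤s ())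
swapAt-beyond (suc (suc k)) [] _ = refl
swapAt-beyond (suc (suc k)) (x ∷ c) (s≤s le) = cong (x ∷_) (swapAt-beyond (suc k) c le)

nth-swapAt-left : ∀ k c → 1 ≤ k → suc k ≤ length c → nth k (swapAt k c) ≡ nth (suc k) c
nth-swapAt-left (suc zero) (x ∷ y ∷ c) _ _ = refl
nth-swapAt-left (suc zero) (x ∷ []) _ (s≤s ())
nth-swapAt-left (suc (suc k)) (x ∷ c) _ (s≤s le) = nth-swapAt-left (suc k) c (s≤s z≤n) le

nth-swapAt-right : ∀ k c → 1 ≤ k → suc k ≤ length c → nth (suc k) (swapAt k c) ≡ nth k c
nth-swapAt-right (suc zero) (x ∷ y ∷ c) _ _ = refl
nth-swapAt-right (suc zero) (x ∷ []) _ (s≤s ())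
nth-swapAt-right (suc (suc k)) (x ∷ c) _ (s≤s le) = nth-swapAt-right (suc k) c (s≤s z≤n) le

nth-swapAt-other : ∀ k m c → m ≢ k → m ≢ suc k → nth m (swapAt k c) ≡ nth m c
nth-swapAt-other zero m c _ _ = refl
nth-swapAt-other (suc zero) m [] _ _ = refl
nth-swapAt-other (suc zero) m (x ∷ []) _ _ = refl
nth-swapAt-other (suc zero) zero (x ∷ y ∷ c) _ _ = refl
nth-swapAt-other (suc zero) (suc zero) (x ∷ y ∷ c) m≢1 _ = ⊥-elim (m≢1 refl)
nth-swapAt-other (suc zero) (suc (suc zero)) (x ∷ y ∷ c) _ m≢2 = ⊥-elim (m≢2 refl)
nth-swapAt-other (suc zero) (suc (suc (suc m))) (x ∷ y ∷ c) _ _ = refl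
nth-swapAt-other (suc (suc k)) m [] _ _ = refl
nth-swapAt-other (suc (suc k)) zero (x ∷ c) _ _ = refl
nth-swapAt-other (suc (suc k)) (suc zero) (x ∷ c) _ _ = refl
nth-swapAt-other (suc (suc k)) (suc (suc m)) (x ∷ c) m≢k m≢sk =
  nth-swapAt-other (suc k) (suc m) c (m≢k ∘′ cong suc) (m≢sk ∘′ cong suc)

nth-swapAt : ∀ k c → 1 ≤ k → suc k ≤ length c → ∀ m → nth m (swapAt k c) ≡ nth (transpose k (suc k) m) c
nth-swapAt k c k≥1 kr m with transpose-cases k (suc k) m
... | inj₁ (refl , e) = trans (nth-swapAt-left k c k≥1 kr) (cong (λ t → nth t c) (sym e))
... | inj₂ (inj₁ (_ , refl , e)) = trans (nth-swapAt-right k c k≥1 kr) (cong (λ t → nth t c) (sym e))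
... | inj₂ (inj₂ (m≢k , m≢sk , e)) = trans (nth-swapAt-other k m c m≢k m≢sk) (cong (λ t → nth t c) (sym e))

nth-inRange : ∀ m c → 0 < nth m c → 1 ≤ m × m ≤ length c
nth-inRange (suc zero) (x ∷ c) _ = s≤s z≤n , s≤s z≤n
nth-inRange (suc (suc m)) (x ∷ c) p = s≤s z≤n , s≤s (proj₂ (nth-inRange (suc m) c p))

transpose-suc-inRange : ∀ k m L → 1 ≤ k → suc k ≤ L → 1 ≤ m → m ≤ L →
  1 ≤ transpose k (suc k) m × transpose k (suc k) m ≤ L
transpose-suc-inRange k m L k≥1 kr m≥1 mr with transpose-cases k (suc k) m
... | inj₁ (refl , e) rewrite e = s≤s z≤n , kr
... | inj₂ (inj₁ (_ , refl , e)) rewrite e = k≥1 , ≤-trans (n≤1+n k) kr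
... | inj₂ (inj₂ (_ , _ , e)) rewrite e = m≥1 , mr

swapAt-braid : ∀ i c → 1 ≤ i → suc (suc i) ≤ length c →
  swapAt (suc i) (swapAt i (swapAt (suc i) c)) ≡ swapAt i (swapAt (suc i) (swapAt i c))
swapAt-braid (suc zero) (x ∷ y ∷ z ∷ c) _ _ = refl
swapAt-braid (suc zero) (x ∷ y ∷ []) _ (s≤s (s≤s ()))
swapAt-braid (suc zero) (x ∷ []) _ (s≤s ())
swapAt-braid (suc (suc i)) (x ∷ c) _ (s≤s le) = cong (x ∷_) (swapAt-braid (suc i) c (s≤s z≤n) le)

Distant : ℕ → ℕ → Set
Distant i j = 2 + i ≤ j ⊎ 2 + j ≤ i

distant-sym : ∀ {i j} → Distant i j → Distant j i
distant-sym (inj₁ le) = inj₂ le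
distant-sym (inj₂ le) = inj₁ le

distant-≢ : ∀ {i j} → Distant i j → j ≢ i × j ≢ suc i × suc j ≢ i
distant-≢ {i} (inj₁ si<j) = >⇒≢ i<j , >⇒≢ si<j , >⇒≢ (m<n⇒m<1+n i<j)
  where i<j = <-trans (n<1+n i) si<j
distant-≢ {j = j} (inj₂ sj<i) = <⇒≢ j<i , <⇒≢ (m<n⇒m<1+n j<i) , <⇒≢ sj<i
  where j<i = <-trans (n<1+n j) sj<i

distant-or-close : ∀ k j → Distant k j ⊎ k ≡ j ⊎ suc k ≡ j ⊎ k ≡ suc j
distant-or-close k j with <-cmp k j
... | tri≈ _ k≡j _ = inj₂ (inj₁ k≡j)
... | tri< k<j _ _ with m≤n⇒m<n∨m≡n k<j
...   | inj₁ sk<j = inj₁ (inj₁ sk<j)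
...   | inj₂ sk≡j = inj₂ (inj₂ (inj₁ sk≡j))
distant-or-close k j | tri> _ _ j<k with m≤n⇒m<n∨m≡n j<k
...   | inj₁ sj<k = inj₁ (inj₂ sj<k)
...   | inj₂ sj≡k = inj₂ (inj₂ (inj₂ (sym sj≡k)))

nth-swapAt-distant : ∀ {i j} c → Distant i j → nth j (swapAt i c) ≡ nth j c
nth-swapAt-distant {i} {j} c d = let (j≢i , j≢si , _) = distant-≢ d in nth-swapAt-other i j c j≢i j≢si

nth-suc-swapAt-distant : ∀ {i j} c → Distant i j → nth (suc j) (swapAt i c) ≡ nth (suc j) c
nth-suc-swapAt-distant {i} {j} c d =
  let (j≢i , _ , sj≢i) = distant-≢ d in nth-swapAt-other i (suc j) c sj≢i (j≢i ∘′ suc-injective)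

swapAt-comm : ∀ i j c → 2 + i ≤ j → swapAt i (swapAt j c) ≡ swapAt j (swapAt i c)
swapAt-comm zero j c _ = refl
swapAt-comm (suc zero) (suc (suc (suc j))) [] _ = refl
swapAt-comm (suc zero) (suc (suc (suc j))) (x ∷ []) _ = refl
swapAt-comm (suc zero) (suc (suc (suc j))) (x ∷ y ∷ c) _ = refl
swapAt-comm (suc zero) (suc zero) c (s≤s ())
swapAt-comm (suc zero) (suc (suc zero)) c (s≤s (s≤s ()))
swapAt-comm (suc (suc i)) (suc zero) c (s≤s ())
swapAt-comm (suc (suc i)) (suc (suc j)) [] _ = refl
swapAt-comm (suc (suc i)) (suc (suc j)) (x ∷ c) (s≤s le) = cong (x ∷_) (swapAt-comm (suc i) (suc j) c le)

swapAt-distant-comm : ∀ {i j} c → Distant i j → swapAt i (swapAt j c) ≡ swapAt j (swapAt i c)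
swapAt-distant-comm {i} {j} c (inj₁ le) = swapAt-comm i j c le
swapAt-distant-comm {i} {j} c (inj₂ le) = sym (swapAt-comm j i c le)

applyWord-++ : ∀ c xs ys → applyWord c (xs ++ ys) ≡ applyWord (applyWord c xs) ys
applyWord-++ c [] ys = refl
applyWord-++ c (x ∷ xs) ys = applyWord-++ (swapAt x c) xs ys

swaps-++ : ∀ c xs ys → swaps c (xs ++ ys) ≡ swaps c xs ++ swaps (applyWord c xs) ys
swaps-++ c [] ys = refl
swaps-++ c (x ∷ xs) ys = cong (_ ∷_) (swaps-++ (swapAt x c) xs ys)

length-∷ʳ : ∀ (c : List ℕ) k → length (c ∷ʳ k) ≡ suc (length c)
length-∷ʳ c k = trans (length-++ c) (+-comm (length c) 1)

Ascending : List ℕ → List ℕ → Set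
Ascending c [] = ⊤
Ascending c (k ∷ a) = (1 ≤ k × nth k c < nth (suc k) c) × Ascending (swapAt k c) a

ascent-inRange : ∀ k c → nth k c < nth (suc k) c → suc k ≤ length c
ascent-inRange k c asc = proj₂ (nth-inRange (suc k) c (≤-<-trans z≤n asc))

Ascending-++⁻ : ∀ c xs ys → Ascending c (xs ++ ys) → Ascending c xs × Ascending (applyWord c xs) ys
Ascending-++⁻ c [] ys asc = tt , asc
Ascending-++⁻ c (x ∷ xs) ys (h , asc) = let (l , r) = Ascending-++⁻ (swapAt x c) xs ys asc in (h , l) , r

Ascending-++⁺ : ∀ c xs ys → Ascending c xs → Ascending (applyWord c xs) ys → Ascending c (xs ++ ys)
Ascending-++⁺ c [] ys _ asc = asc
Ascending-++⁺ c (x ∷ xs) ys (h , l) r = h , Ascending-++⁺ (swapAt x c) xs ys l r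

Commutation-sym : ∀ {a b} → Commutation a b → Commutation b a
Commutation-sym (u , v , i , j , d , refl , refl) = u , v , j , i , distant-sym d , refl , refl

Commutation-++ʳ : ∀ t {a b} → Commutation a b → Commutation (a ++ t) (b ++ t)
Commutation-++ʳ t (u , v , i , j , d , refl , refl) =
  u , v ++ t , i , j , d , ++-assoc u (i ∷ j ∷ v) t , ++-assoc u (j ∷ i ∷ v) t

applyWord-Commutation : ∀ c {a b} → Commutation a b → applyWord c a ≡ applyWord c b
applyWord-Commutation c (u , v , i , j , d , refl , refl) = begin
  applyWord c (u ++ i ∷ j ∷ v)                 ≡⟨ applyWord-++ c u (i ∷ j ∷ v) ⟩
  applyWord (swapAt j (swapAt i c′)) v        ≡⟨ cong (λ z → applyWord z v) (swapAt-distant-comm c′ (distant-sym d)) ⟩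
  applyWord (swapAt i (swapAt j c′)) v        ≡⟨ applyWord-++ c u (j ∷ i ∷ v) ⟨
  applyWord c (u ++ j ∷ i ∷ v)                 ∎
  where open ≡-Reasoning
        c′ = applyWord c u

length-Commutation : ∀ {a b} → Commutation a b → length a ≡ length b
length-Commutation (u , v , i , j , d , refl , refl) = trans (length-++ u) (sym (length-++ u))

AllLetters-Commutation : ∀ n {a b} → Commutation a b → AllLetters n a → AllLetters n b
AllLetters-Commutation n (u , v , i , j , d , refl , refl) = go u
  where
  go : ∀ u → AllLetters n (u ++ i ∷ j ∷ v) → AllLetters n (u ++ j ∷ i ∷ v)
  go [] (li , lj , lv) = lj , li , lv
  go (x ∷ u) (lx , l) = lx , go u l

Ascending-Commutation : ∀ c {a b} → Commutation a b → Ascending c a → Ascending c b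
Ascending-Commutation c (u , v , i , j , d , refl , refl) asc
  with Ascending-++⁻ c u (i ∷ j ∷ v) asc
... | asc-u , (i≥1 , asc-i) , (j≥1 , asc-j) , asc-v =
  Ascending-++⁺ c u (j ∷ i ∷ v) asc-u
    ( (j≥1 , subst₂ _<_ (nth-swapAt-distant c′ d) (nth-suc-swapAt-distant c′ d) asc-j)
    , (i≥1 , subst₂ _<_ (sym (nth-swapAt-distant c′ d′)) (sym (nth-suc-swapAt-distant c′ d′)) asc-i)
    , subst (λ z → Ascending z v) (swapAt-distant-comm c′ d′) asc-v)
  where c′ = applyWord c u
        d′ = distant-sym d

SameClass-invariant : (Q : List ℕ → Set) → (∀ {a b} → Commutation a b → Q a → Q b) →
  ∀ {a b} → SameClass a b → Q a → Q b
SameClass-invariant Q step = Star.fold (λ a b → Q a → Q b) (λ s k → k ∘′ step s) (λ q → q)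

SameClass-sym : ∀ {a b} → SameClass a b → SameClass b a
SameClass-sym = Star.reverse Commutation-sym

SameClass-++ʳ : ∀ t {a b} → SameClass a b → SameClass (a ++ t) (b ++ t)
SameClass-++ʳ t = Star.gmap (_++ t) (Commutation-++ʳ t)

applyWord-SameClass : ∀ c {a b} → SameClass a b → applyWord c a ≡ applyWord c b
applyWord-SameClass c = Star.fold (λ a b → applyWord c a ≡ applyWord c b) (trans ∘′ applyWord-Commutation c) refl

length-SameClass : ∀ {a b} → SameClass a b → length a ≡ length b
length-SameClass = Star.fold (λ a b → length a ≡ length b) (trans ∘′ length-Commutation) refl

Ascending-SameClass : ∀ c {a b} → SameClass a b → Ascending c a → Ascending c b
Ascending-SameClass c = SameClass-invariant (Ascending c) (Ascending-Commutation c)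

-- Inversions and reduced words

<ᵇ-true : ∀ {m n} → m < n → (m <ᵇ n) ≡ true
<ᵇ-true {m} {n} m<n with m <ᵇ n in eq
... | true = refl
... | false = ⊥-elim (subst T eq (<⇒<ᵇ m<n))

<ᵇ-false : ∀ {m n} → ¬ m < n → (m <ᵇ n) ≡ false
<ᵇ-false {m} {n} m≮n with m <ᵇ n in eq
... | false = refl
... | true = ⊥-elim (m≮n (<ᵇ⇒< m n (subst T (sym eq) tt)))

bit : Bool → ℕ
bit b = if b then 1 else 0

countLess-swapAt : ∀ z k c → countLess z (swapAt k c) ≡ countLess z c
countLess-swapAt z zero c = refl
countLess-swapAt z (suc zero) [] = refl
countLess-swapAt z (suc zero) (x ∷ []) = refl
countLess-swapAt z (suc zero) (x ∷ y ∷ c) = x∙yz≈y∙xz (bit (y <ᵇ z)) (bit (x <ᵇ z)) (countLess z c)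
countLess-swapAt z (suc (suc k)) [] = refl
countLess-swapAt z (suc (suc k)) (x ∷ c) = cong (bit (x <ᵇ z) +_) (countLess-swapAt z (suc k) c)

inv-swapAt : ∀ k c → 1 ≤ k → suc k ≤ length c →
  inv (swapAt k c) + bit (nth (suc k) c <ᵇ nth k c) ≡ inv c + bit (nth k c <ᵇ nth (suc k) c)
inv-swapAt (suc zero) (x ∷ y ∷ c) _ _ =
  solve 5 (λ a b p q r → ((a :+ p) :+ (q :+ r)) :+ b := ((b :+ q) :+ (p :+ r)) :+ a) refl
    (bit (x <ᵇ y)) (bit (y <ᵇ x)) (countLess y c) (countLess x c) (inv c)
inv-swapAt (suc zero) (x ∷ []) _ (s≤s ())
inv-swapAt (suc (suc k)) (x ∷ c) _ (s≤s le) = begin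
  countLess x (swapAt (suc k) c) + inv (swapAt (suc k) c) + b₋
    ≡⟨ cong (λ t → t + inv (swapAt (suc k) c) + b₋) (countLess-swapAt x (suc k) c) ⟩
  countLess x c + inv (swapAt (suc k) c) + b₋
    ≡⟨ +-assoc (countLess x c) _ _ ⟩
  countLess x c + (inv (swapAt (suc k) c) + b₋)
    ≡⟨ cong (countLess x c +_) (inv-swapAt (suc k) c (s≤s z≤n) le) ⟩
  countLess x c + (inv c + b₊)
    ≡⟨ +-assoc (countLess x c) _ _ ⟨
  countLess x c + inv c + b₊ ∎
  where open ≡-Reasoning
        b₋ = bit (nth (suc (suc k)) c <ᵇ nth (suc k) c)
        b₊ = bit (nth (suc k) c <ᵇ nth (suc (suc k)) c)

inv-swapAt-ascent : ∀ k c → 1 ≤ k → nth k c < nth (suc k) c → inv (swapAt k c) ≡ suc (inv c)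
inv-swapAt-ascent k c k≥1 asc with inv-swapAt k c k≥1 (ascent-inRange k c asc)
... | e rewrite <ᵇ-false (<⇒≯ asc) | <ᵇ-true asc = trans (sym (+-identityʳ _)) (trans e (+-comm (inv c) 1))

inv-swapAt-descent : ∀ k c → 1 ≤ k → suc k ≤ length c → nth (suc k) c < nth k c →
  suc (inv (swapAt k c)) ≡ inv c
inv-swapAt-descent k c k≥1 kr desc with inv-swapAt k c k≥1 kr
... | e rewrite <ᵇ-false (<⇒≯ desc) | <ᵇ-true desc = trans (+-comm 1 _) (trans e (+-identityʳ _))

inv-swapAt-≤ : ∀ k c → inv (swapAt k c) ≤ suc (inv c) ×
  (inv (swapAt k c) ≡ suc (inv c) → 1 ≤ k × nth k c < nth (suc k) c)
inv-swapAt-≤ zero c = n≤1+n _ , λ e → ⊥-elim (1+n≢n (sym e))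
inv-swapAt-≤ (suc k) c with suc (suc k) ≤? length c
... | no out rewrite swapAt-beyond (suc k) c (≤-pred (≰⇒> out)) = n≤1+n _ , λ e → ⊥-elim (1+n≢n (sym e))
... | yes kr with <-cmp (nth (suc k) c) (nth (suc (suc k)) c)
...   | tri< asc _ _ = ≤-reflexive (inv-swapAt-ascent (suc k) c (s≤s z≤n) asc) , λ _ → s≤s z≤n , asc
...   | tri≈ _ same _ = ≤-trans (≤-reflexive unchanged) (n≤1+n _) , λ e → ⊥-elim (1+n≢n (trans (sym e) unchanged))
  where
  unchanged : inv (swapAt (suc k) c) ≡ inv c
  unchanged with inv-swapAt (suc k) c (s≤s z≤n) kr
  ... | e rewrite same | <ᵇ-false (n≮n (nth (suc (suc k)) c)) = trans (sym (+-identityʳ _)) (trans e (+-identityʳ _))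
...   | tri> _ _ desc = ≤-trans (≤-trans (n≤1+n _) (≤-reflexive down)) (n≤1+n _) ,
          λ e → ⊥-elim (<⇒≢ (m<n⇒m<1+n (n<1+n (inv c))) (trans (sym down) (cong suc e)))
  where down = inv-swapAt-descent (suc k) c (s≤s z≤n) kr desc

inv-applyWord-≤ : ∀ c a → inv (applyWord c a) ≤ inv c + length a ×
  (inv (applyWord c a) ≡ inv c + length a → Ascending c a)
inv-applyWord-≤ c [] = ≤-reflexive (sym (+-identityʳ _)) , λ _ → tt
inv-applyWord-≤ c (k ∷ a) with inv-applyWord-≤ (swapAt k c) a | inv-swapAt-≤ k c
... | (bound , tight) | (bound₁ , tight₁) =
  ≤-trans bound (≤-trans (+-monoˡ-≤ (length a) bound₁) (≤-reflexive (sym (+-suc (inv c) (length a))))) ,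
  λ e → let e′ = trans e (+-suc (inv c) (length a))
            first : inv (swapAt k c) ≡ suc (inv c)
            first = ≤-antisym bound₁ (+-cancelʳ-≤ (length a) _ _ (subst (_≤ inv (swapAt k c) + length a) e′ bound))
        in tight₁ first , tight (trans e′ (cong (_+ length a) (sym first)))

inv-Ascending : ∀ c a → Ascending c a → inv (applyWord c a) ≡ inv c + length a
inv-Ascending c [] _ = sym (+-identityʳ _)
inv-Ascending c (k ∷ a) ((k≥1 , asc) , rest) = begin
  inv (applyWord (swapAt k c) a)   ≡⟨ inv-Ascending (swapAt k c) a rest ⟩
  inv (swapAt k c) + length a      ≡⟨ cong (_+ length a) (inv-swapAt-ascent k c k≥1 asc) ⟩
  suc (inv c) + length a           ≡⟨ +-suc (inv c) (length a) ⟨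
  inv c + suc (length a)           ∎
  where open ≡-Reasoning

interval : ℕ → ℕ → List ℕ
interval s zero = []
interval s (suc n) = s ∷ interval (suc s) n

map-suc-applyUpTo : ∀ n (f : ℕ → ℕ) s → (∀ i → f i ≡ s + i) → map suc (applyUpTo f n) ≡ interval (suc s) n
map-suc-applyUpTo zero f s _ = refl
map-suc-applyUpTo (suc n) f s f≗ = cong₂ _∷_ (cong suc (trans (f≗ 0) (+-identityʳ s)))
  (map-suc-applyUpTo n (f ∘′ suc) (suc s) (λ i → trans (f≗ (suc i)) (+-suc s i)))

idPerm-interval : ∀ n → idPerm n ≡ interval 1 n
idPerm-interval n = map-suc-applyUpTo n (λ i → i) 0 (λ _ → refl)

length-interval : ∀ s n → length (interval s n) ≡ n
length-interval s zero = refl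
length-interval s (suc n) = cong suc (length-interval (suc s) n)

nth-interval : ∀ s n m → m < n → nth (suc m) (interval s n) ≡ s + m
nth-interval s (suc n) zero _ = sym (+-identityʳ s)
nth-interval s (suc n) (suc m) (s≤s m<n) = trans (nth-interval (suc s) n m m<n) (sym (+-suc s m))

countLess-interval : ∀ x s n → x ≤ s → countLess x (interval s n) ≡ 0
countLess-interval x s zero _ = refl
countLess-interval x s (suc n) x≤s rewrite <ᵇ-false (≤⇒≯ x≤s) = countLess-interval x (suc s) n (m≤n⇒m≤1+n x≤s)

inv-interval : ∀ s n → inv (interval s n) ≡ 0
inv-interval s zero = refl
inv-interval s (suc n) rewrite countLess-interval s (suc s) n (n≤1+n s) = inv-interval (suc s) n

length-idPerm : ∀ n → length (idPerm n) ≡ n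
length-idPerm n rewrite idPerm-interval n = length-interval 1 n

inv-idPerm : ∀ n → inv (idPerm n) ≡ 0
inv-idPerm n rewrite idPerm-interval n = inv-interval 1 n

nth-idPerm : ∀ n m → 1 ≤ m → m ≤ n → nth m (idPerm n) ≡ m
nth-idPerm n (suc m) _ m<n rewrite idPerm-interval n = nth-interval 1 n m m<n

NoDescent : List ℕ → Set
NoDescent c = ∀ j → 1 ≤ j → suc j ≤ length c → ¬ nth (suc j) c < nth j c

idPerm-noDescent : ∀ n → NoDescent (idPerm n)
idPerm-noDescent n j j≥1 jr desc =
  <-asym (subst₂ _<_ (nth-idPerm n (suc j) (s≤s z≤n) jr′) (nth-idPerm n j j≥1 (≤-trans (n≤1+n j) jr′)) desc) (n<1+n j)
  where jr′ = subst (suc j ≤_) (length-idPerm n) jr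

reduced⇒ascending : ∀ {n w a} → Reduced n w a → Ascending (idPerm n) a
reduced⇒ascending {n} {w} {a} (_ , |a| , a↦w) = proj₂ (inv-applyWord-≤ (idPerm n) a) (begin
  inv (applyWord (idPerm n) a)   ≡⟨ cong inv a↦w ⟩
  inv w                          ≡⟨ |a| ⟨
  length a                       ≡⟨ cong (_+ length a) (inv-idPerm n) ⟨
  inv (idPerm n) + length a      ∎)
  where open ≡-Reasoning

Distinct : List ℕ → Set
Distinct c = ∀ m m′ → 1 ≤ m → m ≤ length c → 1 ≤ m′ → m′ ≤ length c → nth m c ≡ nth m′ c → m ≡ m′

EntriesIn : ℕ → List ℕ → Set
EntriesIn n c = ∀ m → 1 ≤ m → m ≤ length c → 1 ≤ nth m c × nth m c ≤ n

Distinct-idPerm : ∀ n → Distinct (idPerm n)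
Distinct-idPerm n m m′ m≥1 mr m′≥1 m′r e =
  trans (sym (nth-idPerm n m m≥1 (≤n mr))) (trans e (nth-idPerm n m′ m′≥1 (≤n m′r)))
  where ≤n : ∀ {m} → m ≤ length (idPerm n) → m ≤ n
        ≤n {m} = subst (m ≤_) (length-idPerm n)

EntriesIn-idPerm : ∀ n → EntriesIn n (idPerm n)
EntriesIn-idPerm n m m≥1 mr = subst (λ t → 1 ≤ t × t ≤ n) (sym (nth-idPerm n m m≥1 m≤n)) (m≥1 , m≤n)
  where m≤n = subst (m ≤_) (length-idPerm n) mr

swapAt-trivial-or-inRange : ∀ k c → swapAt k c ≡ c ⊎ (1 ≤ k × suc k ≤ length c)
swapAt-trivial-or-inRange zero c = inj₁ refl
swapAt-trivial-or-inRange (suc k) c with suc (suc k) ≤? length c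
... | yes kr = inj₂ (s≤s z≤n , kr)
... | no out = inj₁ (swapAt-beyond (suc k) c (≤-pred (≰⇒> out)))

Distinct-swapAt : ∀ k c → Distinct c → Distinct (swapAt k c)
Distinct-swapAt k c dist with swapAt-trivial-or-inRange k c
... | inj₁ e rewrite e = dist
... | inj₂ (k≥1 , kr) = λ m m′ m≥1 mr m′≥1 m′r e →
  let (t≥1 , t≤) = range m m≥1 mr
      (t′≥1 , t′≤) = range m′ m′≥1 m′r
      same = dist _ _ t≥1 t≤ t′≥1 t′≤ (trans (sym (nth-swapAt k c k≥1 kr m)) (trans e (nth-swapAt k c k≥1 kr m′)))
  in trans (sym (transpose-involutive k (suc k) m))
       (trans (cong (transpose k (suc k)) same) (transpose-involutive k (suc k) m′))
  where
  range : ∀ m → 1 ≤ m → m ≤ length (swapAt k c) → 1 ≤ transpose k (suc k) m × transpose k (suc k) m ≤ length c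
  range m m≥1 mr = transpose-suc-inRange k m (length c) k≥1 kr m≥1 (subst (m ≤_) (length-swapAt k c) mr)

EntriesIn-swapAt : ∀ n k c → EntriesIn n c → EntriesIn n (swapAt k c)
EntriesIn-swapAt n k c ent with swapAt-trivial-or-inRange k c
... | inj₁ e rewrite e = ent
... | inj₂ (k≥1 , kr) = λ m m≥1 mr →
  let (t≥1 , t≤) = transpose-suc-inRange k m (length c) k≥1 kr m≥1 (subst (m ≤_) (length-swapAt k c) mr)
  in subst (λ t → 1 ≤ t × t ≤ n) (sym (nth-swapAt k c k≥1 kr m)) (ent _ t≥1 t≤)

Distinct-applyWord : ∀ c a → Distinct c → Distinct (applyWord c a)
Distinct-applyWord c [] dist = dist
Distinct-applyWord c (k ∷ a) dist = Distinct-applyWord (swapAt k c) a (Distinct-swapAt k c dist)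

EntriesIn-applyWord : ∀ n c a → EntriesIn n c → EntriesIn n (applyWord c a)
EntriesIn-applyWord n c [] ent = ent
EntriesIn-applyWord n c (k ∷ a) ent = EntriesIn-applyWord n (swapAt k c) a (EntriesIn-swapAt n k c ent)

Before : ℕ → ℕ → List ℕ → Set
Before p q c = ∃[ m ] ∃[ m′ ] (1 ≤ m × m < m′ × m′ ≤ length c × nth m c ≡ p × nth m′ c ≡ q)

Before-swapAt : ∀ {p q} k c → q < p → 1 ≤ k → nth k c < nth (suc k) c → Before p q c → Before p q (swapAt k c)
Before-swapAt k c q<p k≥1 asc (m , m′ , m≥1 , m<m′ , m′r , ep , eq) =
  t m , t m′ , proj₁ (transpose-suc-inRange k m (length c) k≥1 kr m≥1 (≤-trans (<⇒≤ m<m′) m′r)) ,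
  transpose-suc-mono k m m′ m<m′ not-ascent ,
  subst (t m′ ≤_) (sym (length-swapAt k c))
    (proj₂ (transpose-suc-inRange k m′ (length c) k≥1 kr (≤-trans m≥1 (<⇒≤ m<m′)) m′r)) ,
  trans (nth-swapAt k c k≥1 kr (t m)) (trans (cong (λ i → nth i c) (transpose-involutive k (suc k) m)) ep) ,
  trans (nth-swapAt k c k≥1 kr (t m′)) (trans (cong (λ i → nth i c) (transpose-involutive k (suc k) m′)) eq)
  where
  t = transpose k (suc k)
  kr = ascent-inRange k c asc
  not-ascent : ¬ (m ≡ k × m′ ≡ suc k)
  not-ascent (refl , refl) = <-asym q<p (subst₂ _<_ ep eq asc)

Before-applyWord : ∀ {p q} c a → q < p → Ascending c a → Before p q c → Before p q (applyWord c a)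
Before-applyWord c [] _ _ bef = bef
Before-applyWord c (k ∷ a) q<p ((k≥1 , asc) , rest) bef =
  Before-applyWord (swapAt k c) a q<p rest (Before-swapAt k c q<p k≥1 asc bef)

Before-asym : ∀ {p q} c → Distinct c → Before p q c → ¬ Before q p c
Before-asym c dist (m , m′ , m≥1 , m<m′ , m′r , ep , eq) (l , l′ , l≥1 , l<l′ , l′r , ep′ , eq′) =
  <-asym (subst (m <_) (sym l≡m′) m<m′) (subst (l <_) l′≡m l<l′)
  where
  l≡m′ = dist l m′ l≥1 (≤-trans (<⇒≤ l<l′) l′r) (≤-trans m≥1 (<⇒≤ m<m′)) m′r (trans ep′ (sym eq))
  l′≡m = dist l′ m (≤-trans l≥1 (<⇒≤ l<l′)) l′r m≥1 (≤-trans (<⇒≤ m<m′) m′r) (trans eq′ (sym ep))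

eqb-refl : ∀ x → eqb x x ≡ true
eqb-refl x with x ≟ x
... | yes _ = refl
... | no x≢x = ⊥-elim (x≢x refl)

eqb⇒≡ : ∀ {x y} → eqb x y ≡ true → x ≡ y
eqb⇒≡ e = toWitness (subst T (sym e) tt)

posOf-first : ∀ c m p → 1 ≤ m → m ≤ length c → nth m c ≡ p →
  1 ≤ posOf p c × posOf p c ≤ m × nth (posOf p c) c ≡ p
posOf-first (x ∷ c) (suc zero) p _ _ e rewrite e | eqb-refl p = s≤s z≤n , s≤s z≤n , refl
posOf-first (x ∷ c) (suc (suc m)) p _ (s≤s mr) e with eqb x p in x≟p
... | true = s≤s z≤n , s≤s z≤n , eqb⇒≡ x≟p
... | false with posOf p c | posOf-first c (suc m) p (s≤s z≤n) mr e
...   | suc t | _ , t≤ , found = s≤s z≤n , s≤s t≤ , found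

posOf-nth : ∀ c m → Distinct c → 1 ≤ m → m ≤ length c → posOf (nth m c) c ≡ m
posOf-nth c m dist m≥1 mr with posOf-first c m (nth m c) m≥1 mr refl
... | p≥1 , p≤m , found = dist _ m p≥1 (≤-trans p≤m mr) m≥1 mr found

Before⇒posOf< : ∀ {p q} c → Distinct c → Before p q c → posOf p c < posOf q c
Before⇒posOf< c dist (m , m′ , m≥1 , m<m′ , m′r , refl , refl) =
  subst₂ _<_ (sym (posOf-nth c m dist m≥1 (≤-trans (<⇒≤ m<m′) m′r)))
             (sym (posOf-nth c m′ dist (≤-trans m≥1 (<⇒≤ m<m′)) m′r)) m<m′

-- Leftmost descents and a_min

-- A descent at j whose top entry is a left-to-right maximum; the leftmost descent is one.
RecordDescent : List ℕ → ℕ → Set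
RecordDescent w j = 1 ≤ j × suc j ≤ length w × nth (suc j) w < nth j w ×
  (∀ i → 1 ≤ i → i < j → nth i w ≤ nth j w)

firstDescentFrom-nothing : ∀ x xs → firstDescentFrom x xs ≡ nothing →
  (∀ z → z ≤ x → countLess z xs ≡ 0) × inv xs ≡ 0
firstDescentFrom-nothing x [] _ = (λ _ _ → refl) , refl
firstDescentFrom-nothing x (y ∷ ys) eq with y <ᵇ x in y<ᵇx
firstDescentFrom-nothing x (y ∷ ys) () | true
... | false with firstDescentFrom y ys in rest
...   | nothing = (λ z z≤x → cong₂ _+_ (cong bit (<ᵇ-false (λ y<z → <⇒≱ y<z (≤-trans z≤x x≤y))))
                                         (proj₁ ih z (≤-trans z≤x x≤y))) ,
                  cong₂ _+_ (proj₁ ih y ≤-refl) (proj₂ ih)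
  where
  x≤y : x ≤ y
  x≤y = ≮⇒≥ (λ y<x → subst T y<ᵇx (<⇒<ᵇ y<x))
  ih = firstDescentFrom-nothing y ys rest
firstDescentFrom-nothing x (y ∷ ys) () | false | just _

firstDescent-nothing : ∀ w → firstDescent w ≡ nothing → inv w ≡ 0
firstDescent-nothing [] _ = refl
firstDescent-nothing (x ∷ xs) eq = let (none-below , inv≡0) = firstDescentFrom-nothing x xs eq
                                   in cong₂ _+_ (none-below x ≤-refl) inv≡0

firstDescentFrom-record : ∀ x xs d → firstDescentFrom x xs ≡ just d → RecordDescent (x ∷ xs) d
firstDescentFrom-record x (y ∷ ys) d eq with y <ᵇ x in y<ᵇx
firstDescentFrom-record x (y ∷ ys) d refl | true =
  s≤s z≤n , s≤s (s≤s z≤n) , <ᵇ⇒< y x (subst T (sym y<ᵇx) tt) , λ { (suc zero) _ (s≤s ()) }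
... | false with firstDescentFrom y ys in rest
firstDescentFrom-record x (y ∷ ys) d () | false | nothing
firstDescentFrom-record x (y ∷ ys) .(suc d) refl | false | just d
  with firstDescentFrom-record y ys d rest
... | d≥1@(s≤s _) , dr , desc , below = s≤s z≤n , s≤s dr , desc , below′
  where
  x≤y : x ≤ y
  x≤y = ≮⇒≥ (λ y<x → subst T y<ᵇx (<⇒<ᵇ y<x))
  y≤top : y ≤ nth d (y ∷ ys)
  y≤top with m≤n⇒m<n∨m≡n d≥1
  ... | inj₁ 1<d = below 1 (s≤s z≤n) 1<d
  ... | inj₂ refl = ≤-refl
  below′ : ∀ i → 1 ≤ i → i < suc d → nth i (x ∷ y ∷ ys) ≤ nth d (y ∷ ys)
  below′ (suc zero) _ _ = ≤-trans x≤y y≤top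
  below′ (suc (suc i)) _ (s≤s i<d) = below (suc i) (s≤s z≤n) i<d

firstDescent-record : ∀ w d → firstDescent w ≡ just d → RecordDescent w d
firstDescent-record (x ∷ xs) d eq = firstDescentFrom-record x xs d eq

amin-step : ∀ w d → firstDescent w ≡ just d → amin w ≡ amin (swapAt d w) ∷ʳ d
amin-step w d eq with firstDescent-record w d eq
... | d≥1 , dr , desc , _ rewrite sym (inv-swapAt-descent d w d≥1 dr desc) | eq =
  unfold-reverse d (minSeq (inv (swapAt d w)) (swapAt d w))

transpose-suc-<-distant : ∀ k i j → i < j → Distant k j → transpose k (suc k) i < j
transpose-suc-<-distant k i j i<j (inj₁ sk<j) with transpose-cases k (suc k) i
... | inj₁ (refl , e) rewrite e = sk<j
... | inj₂ (inj₁ (_ , refl , e)) rewrite e = <-trans (n<1+n k) sk<j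
... | inj₂ (inj₂ (_ , _ , e)) rewrite e = i<j
transpose-suc-<-distant k i j i<j (inj₂ sj<k) =
  subst (_< j) (sym (transpose-fix k (suc k) i (<⇒≢ i<k) (<⇒≢ (m<n⇒m<1+n i<k)))) i<j
  where i<k = <-trans i<j (<-trans (n<1+n j) sj<k)

recordDescent-unswap-distant : ∀ k j v → Distant k j → 1 ≤ k → nth k v < nth (suc k) v →
  RecordDescent (swapAt k v) j → RecordDescent v j
recordDescent-unswap-distant k j v far k≥1 asc (j≥1 , jr , desc , below) =
  j≥1 , subst (suc j ≤_) (length-swapAt k v) jr ,
  subst₂ _<_ (nth-suc-swapAt-distant v far) (nth-swapAt-distant v far) desc ,
  λ i i≥1 i<j → subst₂ _≤_ (unswap i) (nth-swapAt-distant v far)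
    (below (t i) (proj₁ (transpose-suc-inRange k i (length w) k≥1 kr′ i≥1 (≤-trans (<⇒≤ i<j) (<⇒≤ jr))))
               (transpose-suc-<-distant k i j i<j far))
  where
  w = swapAt k v
  t = transpose k (suc k)
  kr′ : suc k ≤ length w
  kr′ = subst (suc k ≤_) (sym (length-swapAt k v)) (ascent-inRange k v asc)
  unswap : ∀ i → nth (t i) w ≡ nth i v
  unswap i = trans (sym (nth-swapAt k w k≥1 kr′ i)) (cong (nth i) (swapAt-involutive k v))

recordDescent-not-after-ascent : ∀ k v → 1 ≤ k → nth k v < nth (suc k) v → ¬ RecordDescent (swapAt k v) (suc k)
recordDescent-not-after-ascent k v k≥1 asc (_ , _ , _ , below) =
  <⇒≱ asc (subst₂ _≤_ (nth-swapAt-left k v k≥1 kr) (nth-swapAt-right k v k≥1 kr) (below k k≥1 (n<1+n k)))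
  where kr = ascent-inRange k v asc

recordDescent-unswap-above : ∀ j v → nth (suc j) v < nth (suc (suc j)) v →
  RecordDescent (swapAt (suc j) v) j → RecordDescent v j × nth (suc (suc j)) v < nth j v
recordDescent-unswap-above j v asc (j≥1 , jr , desc , below) =
  (j≥1 , subst (suc j ≤_) (length-swapAt (suc j) v) jr , <-trans asc top>q , below′) , top>q
  where
  kr = ascent-inRange (suc j) v asc
  top≡ : nth j (swapAt (suc j) v) ≡ nth j v
  top≡ = nth-swapAt-other (suc j) j v (<⇒≢ (n<1+n j)) (<⇒≢ (m<n⇒m<1+n (n<1+n j)))
  top>q : nth (suc (suc j)) v < nth j v
  top>q = subst₂ _<_ (nth-swapAt-left (suc j) v (s≤s z≤n) kr) top≡ desc
  below′ : ∀ i → 1 ≤ i → i < j → nth i v ≤ nth j v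
  below′ i i≥1 i<j = subst₂ _≤_
    (nth-swapAt-other (suc j) i v (<⇒≢ (m<n⇒m<1+n i<j)) (<⇒≢ (m<n⇒m<1+n (m<n⇒m<1+n i<j)))) top≡ (below i i≥1 i<j)

recordDescent-shift : ∀ j v → suc (suc j) ≤ length v → nth (suc (suc j)) v < nth j v →
  RecordDescent v j → RecordDescent (swapAt j v) (suc j)
recordDescent-shift j v jr top>q (j≥1 , _ , desc , below) =
  s≤s z≤n , subst (suc (suc j) ≤_) (sym (length-swapAt j v)) jr ,
  subst₂ _<_ (sym (nth-swapAt-other j (suc (suc j)) v (>⇒≢ (m<n⇒m<1+n (n<1+n j))) (>⇒≢ (n<1+n (suc j))))) (sym top≡) top>q ,
  below′
  where
  jr′ = ≤-trans (n≤1+n _) jr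
  top≡ : nth (suc j) (swapAt j v) ≡ nth j v
  top≡ = nth-swapAt-right j v j≥1 jr′
  below′ : ∀ i → 1 ≤ i → i < suc j → nth i (swapAt j v) ≤ nth (suc j) (swapAt j v)
  below′ i i≥1 i<sj rewrite top≡ with m≤n⇒m<n∨m≡n (≤-pred i<sj)
  ... | inj₂ refl = subst (_≤ nth j v) (sym (nth-swapAt-left j v j≥1 jr′)) (<⇒≤ desc)
  ... | inj₁ i<j = subst (_≤ nth j v) (sym (nth-swapAt-other j i v (<⇒≢ i<j) (<⇒≢ (m<n⇒m<1+n i<j)))) (below i i≥1 i<j)

EndsWith : List ℕ → ℕ → Set
EndsWith a j = ∃[ e ] SameClass a (e ∷ʳ j)

HasBraidFactor : List ℕ → Set
HasBraidFactor a = ∃[ u ] ∃[ v ] ∃[ i ] (a ≡ u ++ suc i ∷ i ∷ suc i ∷ v)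

ClassHasBraidFactor : List ℕ → Set
ClassHasBraidFactor a = ∃[ a′ ] (SameClass a a′ × HasBraidFactor a′)

ClassHasBraidFactor-++ʳ : ∀ t {a} → ClassHasBraidFactor a → ClassHasBraidFactor (a ++ t)
ClassHasBraidFactor-++ʳ t (a′ , a~a′ , u , v , i , refl) =
  a′ ++ t , SameClass-++ʳ t a~a′ , u , v ++ t , i , ++-assoc u (suc i ∷ i ∷ suc i ∷ v) t

ClassHasBraidFactor-SameClass : ∀ {a b} → SameClass a b → ClassHasBraidFactor b → ClassHasBraidFactor a
ClassHasBraidFactor-SameClass a~b (b′ , b~b′ , factor) = b′ , a~b ◅◅ b~b′ , factor

EndsWith-∷ʳ-distant : ∀ {c j k} → Distant j k → EndsWith c j → EndsWith (c ∷ʳ k) j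
EndsWith-∷ʳ-distant {j = j} {k} far (e , c~ej) =
  e ∷ʳ k , SameClass-++ʳ (k ∷ []) c~ej ◅◅
    subst (λ z → SameClass z ((e ∷ʳ k) ∷ʳ j)) (sym (++-assoc e (j ∷ []) (k ∷ [])))
      ((e , [] , j , k , far , refl , ++-assoc e (k ∷ []) (j ∷ [])) ◅ ε)

applyWord-∷ʳ : ∀ c a k → applyWord c (a ∷ʳ k) ≡ swapAt k (applyWord c a)
applyWord-∷ʳ c a k = applyWord-++ c a (k ∷ [])

length-∷ʳ-≤ : ∀ {N} (c : List ℕ) k → length (c ∷ʳ k) ≤ suc N → length c ≤ N
length-∷ʳ-≤ c k le = ≤-pred (subst (_≤ _) (length-∷ʳ c k) le)

SameClass-∷ʳ-peel : ∀ c₀ {c e j} → SameClass c (e ∷ʳ j) → Ascending c₀ c →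
  Ascending c₀ e × applyWord c₀ e ≡ swapAt j (applyWord c₀ c) × length c ≡ suc (length e)
SameClass-∷ʳ-peel c₀ {c} {e} {j} c~ej asc =
  proj₁ (Ascending-++⁻ c₀ e (j ∷ []) (Ascending-SameClass c₀ c~ej asc)) ,
  trans (sym (swapAt-involutive j _)) (cong (swapAt j) (trans (sym (applyWord-∷ʳ c₀ e j)) (sym (applyWord-SameClass c₀ c~ej)))) ,
  trans (length-SameClass c~ej) (length-∷ʳ e j)

ClassHasBraidFactor-∷ʳ : ∀ {c e j} → SameClass c (e ∷ʳ j) → EndsWith e (suc j) ⊎ ClassHasBraidFactor e →
  ClassHasBraidFactor (c ∷ʳ suc j)
ClassHasBraidFactor-∷ʳ {c} {e} {j} c~ej =
  [ braid , ClassHasBraidFactor-SameClass c~ej-sj ∘′ ClassHasBraidFactor-++ʳ (j ∷ suc j ∷ []) ]′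
  where
  c~ej-sj : SameClass (c ∷ʳ suc j) (e ++ j ∷ suc j ∷ [])
  c~ej-sj = subst (SameClass (c ∷ʳ suc j)) (++-assoc e (j ∷ []) (suc j ∷ [])) (SameClass-++ʳ (suc j ∷ []) c~ej)
  braid : EndsWith e (suc j) → ClassHasBraidFactor (c ∷ʳ suc j)
  braid (f , e~f-sj) = _ , c~ej-sj ◅◅ SameClass-++ʳ (j ∷ suc j ∷ []) e~f-sj ,
                       f , [] , j , ++-assoc f (suc j ∷ []) (j ∷ suc j ∷ [])

-- By induction on the last letter k of a: k = j is immediate, k = j − 1 contradicts the record,
-- a distant k commutes past j, and for k = j + 1 the remaining word ends (up to commutation)
-- in j, before which the record descent has moved to j + 1, giving (j+1) j (j+1).
exchange : ∀ N c₀ a j → length a ≤ N → NoDescent c₀ → Ascending c₀ a →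
  RecordDescent (applyWord c₀ a) j → EndsWith a j ⊎ ClassHasBraidFactor a
exchange N c₀ a j |a|≤N noDesc asc rd with reverseView a
exchange N c₀ .[] j _ noDesc _ (j≥1 , jr , desc , _) | [] = ⊥-elim (noDesc j j≥1 jr desc)
exchange zero c₀ .(c ∷ʳ k) j |a|≤0 _ _ _ | c ∶ _ ∶ʳ k =
  ⊥-elim (1+n≰n (≤-trans (≤-reflexive (sym (length-∷ʳ c k))) (≤-trans |a|≤0 z≤n)))
exchange (suc N) c₀ .(c ∷ʳ k) j |a|≤ noDesc asc rd | c ∶ _ ∶ʳ k
  with Ascending-++⁻ c₀ c (k ∷ []) asc | distant-or-close k j | subst (λ z → RecordDescent z j) (applyWord-∷ʳ c₀ c k) rd
... | asc-c , (k≥1 , asc-k) , _ | inj₁ far | rd′ =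
  map⊎ (EndsWith-∷ʳ-distant (distant-sym far)) (ClassHasBraidFactor-++ʳ (k ∷ []))
    (exchange N c₀ c j (length-∷ʳ-≤ c k |a|≤) noDesc asc-c (recordDescent-unswap-distant k j _ far k≥1 asc-k rd′))
... | _ | inj₂ (inj₁ refl) | _ = inj₁ (c , ε)
... | _ , (k≥1 , asc-k) , _ | inj₂ (inj₂ (inj₁ refl)) | rd′ = ⊥-elim (recordDescent-not-after-ascent k _ k≥1 asc-k rd′)
... | asc-c , (_ , asc-k) , _ | inj₂ (inj₂ (inj₂ refl)) | rd′ with recordDescent-unswap-above j _ asc-k rd′
...   | rd-v , top>q with exchange N c₀ c j (length-∷ʳ-≤ c (suc j) |a|≤) noDesc asc-c rd-v
...     | inj₂ braid = inj₂ (ClassHasBraidFactor-++ʳ (suc j ∷ []) braid)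
...     | inj₁ (e , c~ej) = inj₂ (ClassHasBraidFactor-∷ʳ c~ej (exchange N c₀ e (suc j) |e|≤N noDesc asc-e rd-e))
  where
  v = applyWord c₀ c
  peeled = SameClass-∷ʳ-peel c₀ c~ej asc-c
  asc-e = proj₁ peeled
  |e|≤N = ≤-trans (n≤1+n _) (subst (_≤ N) (proj₂ (proj₂ peeled)) (length-∷ʳ-≤ c (suc j) |a|≤))
  rd-e : RecordDescent (applyWord c₀ e) (suc j)
  rd-e = subst (λ z → RecordDescent z (suc j)) (sym (proj₁ (proj₂ peeled)))
           (recordDescent-shift j v (ascent-inRange (suc j) v asc-k) top>q rd-v)

length≡0⇒[] : ∀ (a : List ℕ) → length a ≡ 0 → a ≡ []
length≡0⇒[] [] _ = refl

-- a_min removes leftmost descents one at a time, and exchange peels the same letters off a.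
amin-or-braid : ∀ N n a → length a ≤ N → Ascending (idPerm n) a →
  SameClass (amin (applyWord (idPerm n) a)) a ⊎ ClassHasBraidFactor a
amin-or-braid N n a |a|≤N asc with firstDescent (applyWord (idPerm n) a) in eq
... | nothing = inj₁ (subst₂ SameClass (sym amin≡[]) (sym (length≡0⇒[] a |a|≡0)) ε)
  where
  w = applyWord (idPerm n) a
  inv≡0 = firstDescent-nothing w eq
  |a|≡0 : length a ≡ 0
  |a|≡0 = trans (sym (trans (inv-Ascending (idPerm n) a asc) (cong (_+ length a) (inv-idPerm n)))) inv≡0
  amin≡[] : amin w ≡ []
  amin≡[] = cong (λ t → reverse (minSeq t w)) inv≡0
... | just d with exchange (length a) (idPerm n) a d ≤-refl (idPerm-noDescent n) asc (firstDescent-record (applyWord (idPerm n) a) d eq)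
...   | inj₂ braid = inj₂ braid
...   | inj₁ (e , a~ed) = recurse N |a|≤N
  where
  w = applyWord (idPerm n) a
  peeled = SameClass-∷ʳ-peel (idPerm n) a~ed asc
  recurse : ∀ M → length a ≤ M → SameClass (amin w) a ⊎ ClassHasBraidFactor a
  recurse zero |a|≤0 = ⊥-elim (1+n≰n (≤-trans (≤-reflexive (sym (proj₂ (proj₂ peeled)))) (≤-trans |a|≤0 z≤n)))
  recurse (suc M) |a|≤ with amin-or-braid M n e (≤-pred (subst (_≤ suc M) (proj₂ (proj₂ peeled)) |a|≤)) (proj₁ peeled)
  ... | inj₂ braid = inj₂ (ClassHasBraidFactor-SameClass a~ed (ClassHasBraidFactor-++ʳ (d ∷ []) braid))
  ... | inj₁ amin~e = inj₁ (subst (λ z → SameClass z a) (sym (amin-step w d eq))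
          (SameClass-++ʳ (d ∷ []) (subst (λ z → SameClass (amin z) e) (proj₁ (proj₂ peeled)) amin~e) ◅◅ SameClass-sym a~ed))

-- Labels and sup

matches : ℕ × ℕ → ℕ → ℕ → Bool
matches e p q = (eqb (proj₁ e) p ∧ eqb (proj₂ e) q) ∨ (eqb (proj₁ e) q ∧ eqb (proj₂ e) p)

matches-ordered : ∀ {u v p q} → u < v → q < p → matches (u , v) p q ≡ true → u ≡ q × v ≡ p
matches-ordered {u} {v} {p} {q} u<v q<p hit with eqb u p in u≟p | eqb v q in v≟q | eqb u q in u≟q | eqb v p in v≟p
... | true | true | _ | _ = ⊥-elim (<-asym q<p (subst₂ _<_ (eqb⇒≡ u≟p) (eqb⇒≡ v≟q) u<v))
... | true | false | true | true = eqb⇒≡ u≟q , eqb⇒≡ v≟p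
... | false | _ | true | true = eqb⇒≡ u≟q , eqb⇒≡ v≟p
matches-ordered u<v q<p () | true | false | true | false
matches-ordered u<v q<p () | true | false | false | _
matches-ordered u<v q<p () | false | _ | true | false
matches-ordered u<v q<p () | false | _ | false | _

matches-false : ∀ {u v p q} → u < v → q < p → ¬ (u ≡ q × v ≡ p) → matches (u , v) p q ≡ false
matches-false {u} {v} {p} {q} u<v q<p not-qp with matches (u , v) p q in hit
... | true = ⊥-elim (not-qp (matches-ordered u<v q<p hit))
... | false = refl

matches-self : ∀ u v → matches (u , v) v u ≡ true
matches-self u v rewrite eqb-refl u | eqb-refl v with eqb u v ∧ eqb v u
... | true = refl
... | false = refl

labelFrom-0-or-≥ : ∀ j L p q → labelFrom j L p q ≡ 0 ⊎ j ≤ labelFrom j L p q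
labelFrom-0-or-≥ j [] p q = inj₁ refl
labelFrom-0-or-≥ j (e ∷ L) p q with matches e p q
... | true = inj₂ ≤-refl
... | false with labelFrom-0-or-≥ (suc j) L p q
...   | inj₁ none = inj₁ none
...   | inj₂ j<label = inj₂ (<⇒≤ j<label)

labelFrom-++ : ∀ j A X X′ p q →
  (labelFrom j (A ++ X) p q ≡ labelFrom j (A ++ X′) p q × labelFrom j (A ++ X) p q < j + length A) ⊎
  (labelFrom j (A ++ X) p q ≡ labelFrom (j + length A) X p q × labelFrom j (A ++ X′) p q ≡ labelFrom (j + length A) X′ p q)
labelFrom-++ j [] X X′ p q rewrite +-identityʳ j = inj₂ (refl , refl)
labelFrom-++ j (e ∷ A) X X′ p q with matches e p q
... | true = inj₁ (refl , subst (j <_) (sym (+-suc j (length A))) (s≤s (m≤m+n j (length A))))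
... | false with labelFrom-++ (suc j) A X X′ p q
...   | inj₁ (same , inside) = inj₁ (same , subst (labelFrom (suc j) (A ++ X) p q <_) (sym (+-suc j (length A))) inside)
...   | inj₂ (l , l′) = inj₂ (trans l (cong (λ t → labelFrom t X p q) (sym (+-suc j (length A)))) ,
                                trans l′ (cong (λ t → labelFrom t X′ p q) (sym (+-suc j (length A)))))

labelFrom-skip : ∀ j A X p q → All (λ e → matches e p q ≡ false) A →
  labelFrom j (A ++ X) p q ≡ labelFrom (j + length A) X p q
labelFrom-skip j [] X p q _ = cong (λ t → labelFrom t X p q) (sym (+-identityʳ j))
labelFrom-skip j (e ∷ A) X p q (miss ∷ misses) rewrite miss =
  trans (labelFrom-skip (suc j) A X p q misses) (cong (λ t → labelFrom t X p q) (sym (+-suc j (length A))))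

labelFrom-lift : ∀ (f : ℕ → ℕ) S X X′ p q → (∀ x → x < 1 + length S → f x ≡ x) →
  labelFrom (1 + length S) X′ p q ≡ f (labelFrom (1 + length S) X p q) →
  labelFrom 1 (S ++ X′) p q ≡ f (labelFrom 1 (S ++ X) p q)
labelFrom-lift f S X X′ p q fixed relabel with labelFrom-++ 1 S X X′ p q
... | inj₁ (same , inside) = trans (sym same) (sym (fixed _ inside))
... | inj₂ (l , l′) = trans l′ (trans relabel (cong f (sym l)))

labelFrom-hit : ∀ S X e L p q → labelFrom 1 (S ++ X ++ e ∷ L) p q ≡ length X + suc (length S) → matches e p q ≡ true
labelFrom-hit S X e L p q label with labelFrom-++ 1 S (X ++ e ∷ L) (X ++ e ∷ L) p q
... | inj₁ (_ , inside) = ⊥-elim (<⇒≱ inside (subst (suc (length S) ≤_) (sym label) (m≤n+m _ (length X))))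
... | inj₂ (l , _) = hit (length S) X (trans (sym l) label)
  where
  hit : ∀ j X → labelFrom (suc j) (X ++ e ∷ L) p q ≡ length X + suc j → matches e p q ≡ true
  hit j [] found with matches e p q
  ... | true = refl
  ... | false with labelFrom-0-or-≥ (suc (suc j)) L p q
  ...   | inj₁ none = ⊥-elim (1+n≢0 (trans (sym found) none))
  ...   | inj₂ ≥ = ⊥-elim (1+n≰n (subst (suc (suc j) ≤_) found ≥))
  hit j (x ∷ X) found with matches x p q
  ... | true = ⊥-elim (<⇒≢ (s≤s (m≤n+m (suc j) (length X))) found)
  ... | false = hit (suc j) X (trans found (sym (+-suc (length X) (suc j))))

labelFrom-swap₂ : ∀ s e₁ e₂ R p q → 1 ≤ s → ¬ (matches e₁ p q ≡ true × matches e₂ p q ≡ true) →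
  labelFrom s (e₂ ∷ e₁ ∷ R) p q ≡ transpose s (suc s) (labelFrom s (e₁ ∷ e₂ ∷ R) p q)
labelFrom-swap₂ s e₁ e₂ R p q s≥1 not-both with matches e₁ p q | matches e₂ p q
... | true | true = ⊥-elim (not-both (refl , refl))
... | true | false = sym (transpose-applyˡ s (suc s))
... | false | true = sym (transpose-applyʳ s (suc s) 1+n≢n)
... | false | false with labelFrom-0-or-≥ (2 + s) R p q
...   | inj₁ none rewrite none = sym (transpose-fix s (suc s) 0 (<⇒≢ s≥1) λ ())
...   | inj₂ far = sym (transpose-fix s (suc s) _ (>⇒≢ (<-trans (n<1+n s) far)) (>⇒≢ far))

labelFrom-reverse₃ : ∀ s e₁ e₂ e₃ R p q → 1 ≤ s →
  ¬ (matches e₁ p q ≡ true × matches e₂ p q ≡ true) → ¬ (matches e₁ p q ≡ true × matches e₃ p q ≡ true) →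
  ¬ (matches e₂ p q ≡ true × matches e₃ p q ≡ true) →
  labelFrom s (e₃ ∷ e₂ ∷ e₁ ∷ R) p q ≡ transpose s (2 + s) (labelFrom s (e₁ ∷ e₂ ∷ e₃ ∷ R) p q)
labelFrom-reverse₃ s e₁ e₂ e₃ R p q s≥1 ¬12 ¬13 ¬23 with matches e₁ p q | matches e₂ p q | matches e₃ p q
... | true | true | _ = ⊥-elim (¬12 (refl , refl))
... | true | false | true = ⊥-elim (¬13 (refl , refl))
... | false | true | true = ⊥-elim (¬23 (refl , refl))
... | true | false | false = sym (transpose-applyˡ s (2 + s))
... | false | true | false = sym (transpose-fix s (2 + s) (suc s) 1+n≢n (<⇒≢ (n<1+n (suc s))))
... | false | false | true = sym (transpose-applyʳ s (2 + s) (>⇒≢ (m<n⇒m<1+n (n<1+n s))))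
... | false | false | false with labelFrom-0-or-≥ (3 + s) R p q
...   | inj₁ none rewrite none = sym (transpose-fix s (2 + s) 0 (<⇒≢ s≥1) λ ())
...   | inj₂ far = sym (transpose-fix s (2 + s) _ (>⇒≢ (<-trans (m<n⇒m<1+n (n<1+n s)) far)) (>⇒≢ far))

both-match : ∀ {u v u′ v′ p q} → u < v → u′ < v′ → q < p →
  matches (u , v) p q ≡ true → matches (u′ , v′) p q ≡ true → u ≡ u′ × v ≡ v′
both-match u<v u′<v′ q<p hit hit′ with matches-ordered u<v q<p hit | matches-ordered u′<v′ q<p hit′
... | u≡q , v≡p | u′≡q , v′≡p = trans u≡q (sym u′≡q) , trans v≡p (sym v′≡p)

chained : ∀ {u v u′ v′ x y z} → u < v → u′ < v′ → x < y → y < z →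
  matches (u , v) z y ≡ true → matches (u′ , v′) y x ≡ true → u ≡ v′
chained u<v u′<v′ x<y y<z hit hit′ =
  trans (proj₁ (matches-ordered u<v y<z hit)) (sym (proj₂ (matches-ordered u′<v′ x<y hit′)))

-- Γ(a, (x, y, z)) = 1, read off the list of pairs swapped by a.
Γ : List (ℕ × ℕ) → ℕ × ℕ × ℕ → Set
Γ L (x , y , z) = labelFrom 1 L z y < labelFrom 1 L y x

-- Swapping two consecutive swaps moves labels by the transposition (s s+1); this can only
-- create a new pattern if the first swap is (y, z) and the second is (x, y).
Γ-swap : ∀ {u₁ v₁ u₂ v₂} → u₁ < v₁ → u₂ < v₂ → u₁ ≢ u₂ → u₁ ≢ v₂ →
  ∀ S R {x y z} → x < y → y < z →
  Γ (S ++ (u₁ , v₁) ∷ (u₂ , v₂) ∷ R) (x , y , z) → Γ (S ++ (u₂ , v₂) ∷ (u₁ , v₁) ∷ R) (x , y , z)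
Γ-swap {u₁} {v₁} {u₂} {v₂} u₁<v₁ u₂<v₂ u₁≢u₂ u₁≢v₂ S R {x} {y} {z} x<y y<z holds =
  subst₂ _<_ (sym (relabel z y y<z)) (sym (relabel y x x<y)) (transpose-suc-mono s _ _ holds not-consecutive)
  where
  s = 1 + length S
  E₁ = (u₁ , v₁)
  E₂ = (u₂ , v₂)
  relabel : ∀ p q → q < p →
    labelFrom 1 (S ++ E₂ ∷ E₁ ∷ R) p q ≡ transpose s (suc s) (labelFrom 1 (S ++ E₁ ∷ E₂ ∷ R) p q)
  relabel p q q<p = labelFrom-lift (transpose s (suc s)) S (E₁ ∷ E₂ ∷ R) (E₂ ∷ E₁ ∷ R) p q
    (λ l l<s → transpose-fix s (suc s) l (<⇒≢ l<s) (<⇒≢ (m<n⇒m<1+n l<s)))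
    (labelFrom-swap₂ s E₁ E₂ R p q (s≤s z≤n)
      λ (h₁ , h₂) → u₁≢u₂ (proj₁ (both-match u₁<v₁ u₂<v₂ q<p h₁ h₂)))
  not-consecutive : ¬ (labelFrom 1 (S ++ E₁ ∷ E₂ ∷ R) z y ≡ s × labelFrom 1 (S ++ E₁ ∷ E₂ ∷ R) y x ≡ suc s)
  not-consecutive (l₁ , l₂) =
    u₁≢v₂ (chained u₁<v₁ u₂<v₂ x<y y<z (labelFrom-hit S [] E₁ (E₂ ∷ R) z y l₁) (labelFrom-hit S (E₁ ∷ []) E₂ R y x l₂))

module _ {α β γ : ℕ} (α<β : α < β) (β<γ : β < γ) (S R : List (ℕ × ℕ)) where

  private
    s = 1 + length S
    α<γ = <-trans α<β β<γ
    upper = S ++ (β , γ) ∷ (α , γ) ∷ (α , β) ∷ R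
    lower = S ++ (α , β) ∷ (α , γ) ∷ (β , γ) ∷ R

  labelFrom-braid : ∀ p q → q < p → labelFrom 1 lower p q ≡ transpose s (2 + s) (labelFrom 1 upper p q)
  labelFrom-braid p q q<p = labelFrom-lift (transpose s (2 + s)) S _ _ p q
    (λ l l<s → transpose-fix s (2 + s) l (<⇒≢ l<s) (<⇒≢ (m<n⇒m<1+n (m<n⇒m<1+n l<s))))
    (labelFrom-reverse₃ s (β , γ) (α , γ) (α , β) R p q (s≤s z≤n)
      (λ (h₁ , h₂) → <⇒≢ α<β (sym (proj₁ (both-match β<γ α<γ q<p h₁ h₂))))
      (λ (h₁ , h₃) → <⇒≢ α<β (sym (proj₁ (both-match β<γ α<β q<p h₁ h₃))))
      (λ (h₂ , h₃) → <⇒≢ β<γ (sym (proj₂ (both-match α<γ α<β q<p h₂ h₃)))))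

  Γ-braid-⊆ : ∀ {x y z} → x < y → y < z → Γ lower (x , y , z) → Γ upper (x , y , z)
  Γ-braid-⊆ {x} {y} {z} x<y y<z holds
    with transpose-2+-reflects-< s _ _ (subst₂ _<_ (labelFrom-braid z y y<z) (labelFrom-braid y x x<y) holds)
  ... | inj₁ lt = lt
  ... | inj₂ (inj₁ (l₁ , l₂)) = ⊥-elim (<⇒≢ α<γ (chained α<γ β<γ x<y y<z m₁ m₂))
    where m₁ = labelFrom-hit S ((β , γ) ∷ []) (α , γ) ((α , β) ∷ R) z y l₁
          m₂ = labelFrom-hit S [] (β , γ) ((α , γ) ∷ (α , β) ∷ R) y x l₂
  ... | inj₂ (inj₂ (inj₁ (l₁ , l₂))) = ⊥-elim (<⇒≢ α<γ (chained α<β β<γ x<y y<z m₁ m₂))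
    where m₁ = labelFrom-hit S ((β , γ) ∷ (α , γ) ∷ []) (α , β) R z y l₁
          m₂ = labelFrom-hit S [] (β , γ) ((α , γ) ∷ (α , β) ∷ R) y x l₂
  ... | inj₂ (inj₂ (inj₂ (l₁ , l₂))) = ⊥-elim (<⇒≢ α<γ (chained α<β α<γ x<y y<z m₁ m₂))
    where m₁ = labelFrom-hit S ((β , γ) ∷ (α , γ) ∷ []) (α , β) R z y l₁
          m₂ = labelFrom-hit S ((β , γ) ∷ []) (α , γ) ((α , β) ∷ R) y x l₂

  Γ-braid-lost : All (λ e → matches e γ β ≡ false) S → All (λ e → matches e β α ≡ false) S →
    Γ upper (α , β , γ) × ¬ Γ lower (α , β , γ)
  Γ-braid-lost no-γβ no-βα =
    subst₂ _<_ (sym l-γβ) (sym l-βα) s<2+s , λ holds → <-asym s<2+s (subst₂ _<_ l′-γβ l′-βα holds)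
    where
    s<2+s = m<n⇒m<1+n (n<1+n s)
    l-γβ : labelFrom 1 upper γ β ≡ s
    l-γβ rewrite labelFrom-skip 1 S ((β , γ) ∷ (α , γ) ∷ (α , β) ∷ R) γ β no-γβ | matches-self β γ = refl
    l-βα : labelFrom 1 upper β α ≡ 2 + s
    l-βα rewrite labelFrom-skip 1 S ((β , γ) ∷ (α , γ) ∷ (α , β) ∷ R) β α no-βα
               | matches-false β<γ α<β (λ (β≡α , _) → >⇒≢ α<β β≡α)
               | matches-false α<γ α<β (λ (_ , γ≡β) → >⇒≢ β<γ γ≡β)
               | matches-self α β = refl
    l′-γβ : labelFrom 1 lower γ β ≡ 2 + s
    l′-γβ = trans (labelFrom-braid γ β β<γ) (trans (cong (transpose s (2 + s)) l-γβ) (transpose-applyˡ s (2 + s)))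
    l′-βα : labelFrom 1 lower β α ≡ s
    l′-βα = trans (labelFrom-braid β α α<β) (trans (cong (transpose s (2 + s)) l-βα) (transpose-applyʳ s (2 + s) (>⇒≢ s<2+s)))

swaps-inverted : ∀ c a → Ascending c a →
  All (λ e → proj₁ e < proj₂ e × Before (proj₂ e) (proj₁ e) (applyWord c a)) (swaps c a)
swaps-inverted c [] _ = []
swaps-inverted c (k ∷ a) ((k≥1 , asc) , rest) =
  (asc , Before-applyWord (swapAt k c) a asc rest
           (k , suc k , k≥1 , n<1+n k , subst (suc k ≤_) (sym (length-swapAt k c)) kr ,
            nth-swapAt-left k c k≥1 kr , nth-swapAt-right k c k≥1 kr))
  ∷ swaps-inverted (swapAt k c) a rest
  where kr = ascent-inRange k c asc

swaps-miss : ∀ {p q} c a → Ascending c a → Distinct (applyWord c a) → q < p → Before q p (applyWord c a) →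
  All (λ e → matches e p q ≡ false) (swaps c a)
swaps-miss {p} {q} c a asc dist q<p q-before-p = All.map miss (swaps-inverted c a asc)
  where
  miss : ∀ {e} → proj₁ e < proj₂ e × Before (proj₂ e) (proj₁ e) (applyWord c a) → matches e p q ≡ false
  miss (lt , bef) = matches-false lt q<p λ (e₁≡q , e₂≡p) →
    Before-asym (applyWord c a) dist q-before-p (subst₂ (λ p′ q′ → Before p′ q′ (applyWord c a)) e₂≡p e₁≡q bef)

Γ-Commutation : ∀ n {a b} → Ascending (idPerm n) a → Commutation a b → ∀ {x y z} → x < y → y < z →
  Γ (swaps (idPerm n) a) (x , y , z) → Γ (swaps (idPerm n) b) (x , y , z)
Γ-Commutation n asc (u , v , i , j , far , refl , refl) x<y y<z holds =
  subst (λ L → Γ L _) (sym swaps-b)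
    (Γ-swap asc-i asc-j u₁≢u₂ u₁≢v₂ S R x<y y<z (subst (λ L → Γ L _) swaps-a holds))
  where
  c = applyWord (idPerm n) u
  S = swaps (idPerm n) u
  R = swaps (swapAt j (swapAt i c)) v
  parts = Ascending-++⁻ (idPerm n) u (i ∷ j ∷ v) asc
  i≥1 = proj₁ (proj₁ (proj₂ parts))
  j≥1 = proj₁ (proj₁ (proj₂ (proj₂ parts)))
  asc-i : nth i c < nth (suc i) c
  asc-i = proj₂ (proj₁ (proj₂ parts))
  asc-j : nth j c < nth (suc j) c
  asc-j = subst₂ _<_ (nth-swapAt-distant c far) (nth-suc-swapAt-distant c far) (proj₂ (proj₁ (proj₂ (proj₂ parts))))
  dist : Distinct c
  dist = Distinct-applyWord (idPerm n) u (Distinct-idPerm n)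
  ir = ascent-inRange i c asc-i
  jr = ascent-inRange j c asc-j
  u₁≢u₂ : nth i c ≢ nth j c
  u₁≢u₂ e = proj₁ (distant-≢ far) (sym (dist i j i≥1 (≤-trans (n≤1+n i) ir) j≥1 (≤-trans (n≤1+n j) jr) e))
  u₁≢v₂ : nth i c ≢ nth (suc j) c
  u₁≢v₂ e = proj₂ (proj₂ (distant-≢ far)) (sym (dist i (suc j) i≥1 (≤-trans (n≤1+n i) ir) (s≤s z≤n) jr e))
  swaps-a : swaps (idPerm n) (u ++ i ∷ j ∷ v) ≡ S ++ (nth i c , nth (suc i) c) ∷ (nth j c , nth (suc j) c) ∷ R
  swaps-a = trans (swaps-++ (idPerm n) u (i ∷ j ∷ v))
    (cong (λ E → S ++ _ ∷ E ∷ R) (cong₂ _,_ (nth-swapAt-distant c far) (nth-suc-swapAt-distant c far)))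
  swaps-b : swaps (idPerm n) (u ++ j ∷ i ∷ v) ≡ S ++ (nth j c , nth (suc j) c) ∷ (nth i c , nth (suc i) c) ∷ R
  swaps-b = trans (swaps-++ (idPerm n) u (j ∷ i ∷ v))
    (cong₂ (λ E R′ → S ++ _ ∷ E ∷ R′)
      (cong₂ _,_ (nth-swapAt-distant c (distant-sym far)) (nth-suc-swapAt-distant c (distant-sym far)))
      (cong (λ z → swaps z v) (swapAt-distant-comm c far)))

InSup-SameClass : ∀ n w {a b} → Ascending (idPerm n) a → SameClass a b → ∀ τ → InSup n w a τ → InSup n w b τ
InSup-SameClass n w asc a~b (x , y , z) (inT@(_ , x<y , y<z , _) , holds) =
  inT , proj₂ (SameClass-invariant (λ a → Ascending (idPerm n) a × Γ (swaps (idPerm n) a) (x , y , z))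
                 (λ step (asc′ , holds′) → Ascending-Commutation (idPerm n) step asc′ ,
                                             Γ-Commutation n asc′ step x<y y<z holds′)
                 a~b (asc , holds))

module BraidWindow (c : List ℕ) (i : ℕ) (asc : Ascending c (suc i ∷ i ∷ suc i ∷ [])) where

  α β γ : ℕ
  α = nth i c
  β = nth (suc i) c
  γ = nth (suc (suc i)) c

  c₃ : List ℕ
  c₃ = applyWord c (suc i ∷ i ∷ suc i ∷ [])

  i≥1 : 1 ≤ i
  i≥1 = proj₁ (proj₁ (proj₂ asc))

  window : suc (suc i) ≤ length c
  window = ascent-inRange (suc i) c (proj₂ (proj₁ asc))

  private
    c₁ = swapAt (suc i) c
    c₂ = swapAt i c₁
    d₁ = swapAt i c
    d₂ = swapAt (suc i) d₁
    w₁ : suc (suc i) ≤ length c₁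
    w₁ = subst (suc (suc i) ≤_) (sym (length-swapAt (suc i) c)) window
    w₂ : suc (suc i) ≤ length c₂
    w₂ = subst (suc (suc i) ≤_) (sym (length-swapAt i c₁)) w₁
    d-w₁ : suc (suc i) ≤ length d₁
    d-w₁ = subst (suc (suc i) ≤_) (sym (length-swapAt i c)) window
    i≢si : i ≢ suc i
    i≢si = <⇒≢ (n<1+n i)
    i≢ssi : i ≢ suc (suc i)
    i≢ssi = <⇒≢ (m<n⇒m<1+n (n<1+n i))
    ssi≢si : suc (suc i) ≢ suc i
    ssi≢si = >⇒≢ (n<1+n (suc i))
    c₁-i : nth i c₁ ≡ α
    c₁-i = nth-swapAt-other (suc i) i c i≢si i≢ssi
    c₁-si : nth (suc i) c₁ ≡ γ
    c₁-si = nth-swapAt-left (suc i) c (s≤s z≤n) window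
    c₁-ssi : nth (suc (suc i)) c₁ ≡ β
    c₁-ssi = nth-swapAt-right (suc i) c (s≤s z≤n) window
    c₂-i : nth i c₂ ≡ γ
    c₂-i = trans (nth-swapAt-left i c₁ i≥1 (≤-trans (n≤1+n _) w₁)) c₁-si
    c₂-si : nth (suc i) c₂ ≡ α
    c₂-si = trans (nth-swapAt-right i c₁ i≥1 (≤-trans (n≤1+n _) w₁)) c₁-i
    c₂-ssi : nth (suc (suc i)) c₂ ≡ β
    c₂-ssi = trans (nth-swapAt-other i (suc (suc i)) c₁ (≢-sym i≢ssi) ssi≢si) c₁-ssi
    d₁-i : nth i d₁ ≡ β
    d₁-i = nth-swapAt-left i c i≥1 (≤-trans (n≤1+n _) window)
    d₁-si : nth (suc i) d₁ ≡ α
    d₁-si = nth-swapAt-right i c i≥1 (≤-trans (n≤1+n _) window)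
    d₁-ssi : nth (suc (suc i)) d₁ ≡ γ
    d₁-ssi = nth-swapAt-other i (suc (suc i)) c (≢-sym i≢ssi) ssi≢si
    d₂-i : nth i d₂ ≡ β
    d₂-i = trans (nth-swapAt-other (suc i) i d₁ i≢si i≢ssi) d₁-i
    d₂-si : nth (suc i) d₂ ≡ γ
    d₂-si = trans (nth-swapAt-left (suc i) d₁ (s≤s z≤n) d-w₁) d₁-ssi

  β<γ : β < γ
  β<γ = proj₂ (proj₁ asc)

  α<γ : α < γ
  α<γ = subst₂ _<_ c₁-i c₁-si (proj₂ (proj₁ (proj₂ asc)))

  α<β : α < β
  α<β = subst₂ _<_ c₂-si c₂-ssi (proj₂ (proj₁ (proj₂ (proj₂ asc))))

  swaps-upper : swaps c (suc i ∷ i ∷ suc i ∷ []) ≡ (β , γ) ∷ (α , γ) ∷ (α , β) ∷ []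
  swaps-upper = cong₂ (λ E₂ E₃ → (β , γ) ∷ E₂ ∷ E₃ ∷ []) (cong₂ _,_ c₁-i c₁-si) (cong₂ _,_ c₂-si c₂-ssi)

  swaps-lower : swaps c (i ∷ suc i ∷ i ∷ []) ≡ (α , β) ∷ (α , γ) ∷ (β , γ) ∷ []
  swaps-lower = cong₂ (λ E₂ E₃ → (α , β) ∷ E₂ ∷ E₃ ∷ []) (cong₂ _,_ d₁-si d₁-ssi) (cong₂ _,_ d₂-i d₂-si)

  applyWord-lower : applyWord c (i ∷ suc i ∷ i ∷ []) ≡ c₃
  applyWord-lower = sym (swapAt-braid i c i≥1 window)

  γ-before-β : Before γ β c₃
  γ-before-β = i , suc i , i≥1 , n<1+n i , ≤-trans (n≤1+n _) w₃ ,
               trans (nth-swapAt-other (suc i) i c₂ i≢si i≢ssi) c₂-i ,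
               trans (nth-swapAt-left (suc i) c₂ (s≤s z≤n) w₂) c₂-ssi
    where w₃ = subst (suc (suc i) ≤_) (sym (length-swapAt (suc i) c₂)) w₂

  β-before-α : Before β α c₃
  β-before-α = suc i , suc (suc i) , s≤s z≤n , n<1+n _ , w₃ ,
               trans (nth-swapAt-left (suc i) c₂ (s≤s z≤n) w₂) c₂-ssi ,
               trans (nth-swapAt-right (suc i) c₂ (s≤s z≤n) w₂) c₂-si
    where w₃ = subst (suc (suc i) ≤_) (sym (length-swapAt (suc i) c₂)) w₂

  β-before-γ : Before β γ c
  β-before-γ = suc i , suc (suc i) , s≤s z≤n , n<1+n _ , window , refl , refl

  α-before-β : Before α β c
  α-before-β = i , suc i , i≥1 , n<1+n _ , ≤-trans (n≤1+n _) window , refl , refl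

module BraidMove (c u v : List ℕ) (i : ℕ) (asc : Ascending c (u ++ suc i ∷ i ∷ suc i ∷ v)) where

  c′ : List ℕ
  c′ = applyWord c u

  asc-u : Ascending c u
  asc-u = proj₁ (Ascending-++⁻ c u _ asc)

  asc-window : Ascending c′ (suc i ∷ i ∷ suc i ∷ [])
  asc-window = proj₁ (Ascending-++⁻ c′ (suc i ∷ i ∷ suc i ∷ []) v (proj₂ (Ascending-++⁻ c u _ asc)))

  open BraidWindow c′ i asc-window public

  asc-v : Ascending c₃ v
  asc-v = proj₂ (Ascending-++⁻ c′ (suc i ∷ i ∷ suc i ∷ []) v (proj₂ (Ascending-++⁻ c u _ asc)))

  applyWord-upper : applyWord c (u ++ suc i ∷ i ∷ suc i ∷ v) ≡ applyWord c₃ v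
  applyWord-upper = applyWord-++ c u _

  applyWord-braid : applyWord c (u ++ i ∷ suc i ∷ i ∷ v) ≡ applyWord c (u ++ suc i ∷ i ∷ suc i ∷ v)
  applyWord-braid = trans (applyWord-++ c u _) (trans (cong (λ z → applyWord z v) applyWord-lower) (sym applyWord-upper))

  swaps-upper′ : swaps c (u ++ suc i ∷ i ∷ suc i ∷ v) ≡ swaps c u ++ (β , γ) ∷ (α , γ) ∷ (α , β) ∷ swaps c₃ v
  swaps-upper′ = trans (swaps-++ c u _) (cong (swaps c u ++_)
    (trans (swaps-++ c′ (suc i ∷ i ∷ suc i ∷ []) v) (cong (_++ swaps c₃ v) swaps-upper)))

  swaps-lower′ : swaps c (u ++ i ∷ suc i ∷ i ∷ v) ≡ swaps c u ++ (α , β) ∷ (α , γ) ∷ (β , γ) ∷ swaps c₃ v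
  swaps-lower′ = trans (swaps-++ c u _) (cong (swaps c u ++_)
    (trans (swaps-++ c′ (i ∷ suc i ∷ i ∷ []) v) (cong₂ _++_ swaps-lower (cong (λ z → swaps z v) applyWord-lower))))

Reduced-SameClass : ∀ {n w a b} → SameClass a b → Reduced n w a → Reduced n w b
Reduced-SameClass {n} a~b (letters , |a| , a↦w) =
  SameClass-invariant (AllLetters n) (AllLetters-Commutation n) a~b letters ,
  trans (sym (length-SameClass a~b)) |a| ,
  trans (sym (applyWord-SameClass (idPerm n) a~b)) a↦w

Reduced-braid : ∀ {n w} u v i → Reduced n w (u ++ suc i ∷ i ∷ suc i ∷ v) → Reduced n w (u ++ i ∷ suc i ∷ i ∷ v)
Reduced-braid {n} u v i red@(letters , |a| , a↦w) =
  braid-letters u letters ,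
  trans (length-++ u) (trans (sym (length-++ u)) |a|) ,
  trans (BraidMove.applyWord-braid (idPerm n) u v i (reduced⇒ascending red)) a↦w
  where
  braid-letters : ∀ u → AllLetters n (u ++ suc i ∷ i ∷ suc i ∷ v) → AllLetters n (u ++ i ∷ suc i ∷ i ∷ v)
  braid-letters [] (l₁ , l₂ , _ , lv) = l₂ , l₁ , l₂ , lv
  braid-letters (x ∷ u) (lx , l) = lx , braid-letters u l

-- The lost triple consists of the entries α < β < γ in positions i, i+1, i+2 just before the braid.
braid-shrinks-sup : ∀ n w u v i → Reduced n w (u ++ suc i ∷ i ∷ suc i ∷ v) →
  (∀ τ → InSup n w (u ++ i ∷ suc i ∷ i ∷ v) τ → InSup n w (u ++ suc i ∷ i ∷ suc i ∷ v) τ) ×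
  ∃[ τ ] (InSup n w (u ++ suc i ∷ i ∷ suc i ∷ v) τ × ¬ InSup n w (u ++ i ∷ suc i ∷ i ∷ v) τ)
braid-shrinks-sup n w u v i red@(_ , _ , a↦w) =
  (λ { (x , y , z) (inT@(_ , x<y , y<z , _) , holds) → inT , to-upper (Γ-braid-⊆ α<β β<γ S R x<y y<z (from-lower holds)) }) ,
  (α , β , γ) , (inT , to-upper (proj₁ lost)) , (λ (_ , holds) → proj₂ lost (from-lower holds))
  where
  open BraidMove (idPerm n) u v i (reduced⇒ascending red)
  S = swaps (idPerm n) u
  R = swaps c₃ v
  to-upper : ∀ {τ} → Γ (S ++ (β , γ) ∷ (α , γ) ∷ (α , β) ∷ R) τ → Γ (swaps (idPerm n) (u ++ suc i ∷ i ∷ suc i ∷ v)) τ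
  to-upper = subst (λ L → Γ L _) (sym swaps-upper′)
  from-lower : ∀ {τ} → Γ (swaps (idPerm n) (u ++ i ∷ suc i ∷ i ∷ v)) τ → Γ (S ++ (α , β) ∷ (α , γ) ∷ (β , γ) ∷ R) τ
  from-lower = subst (λ L → Γ L _) swaps-lower′
  c₃↦w : applyWord c₃ v ≡ w
  c₃↦w = trans (sym applyWord-upper) a↦w
  dist-c′ = Distinct-applyWord (idPerm n) u (Distinct-idPerm n)
  dist-w = subst Distinct c₃↦w (Distinct-applyWord c₃ v (Distinct-applyWord c′ (suc i ∷ i ∷ suc i ∷ []) dist-c′))
  before-in-w : ∀ {p q} → q < p → Before p q c₃ → posOf p w < posOf q w
  before-in-w q<p bef = Before⇒posOf< w dist-w (subst (Before _ _) c₃↦w (Before-applyWord c₃ v q<p asc-v bef))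
  entries = EntriesIn-applyWord n (idPerm n) u (EntriesIn-idPerm n)
  inT : InT n w (α , β , γ)
  inT = proj₁ (entries i i≥1 (≤-trans (n≤1+n i) (≤-trans (n≤1+n _) window))) , α<β , β<γ ,
        proj₂ (entries (suc (suc i)) (s≤s z≤n) window) ,
        before-in-w β<γ γ-before-β , before-in-w α<β β-before-α
  lost = Γ-braid-lost α<β β<γ S R (swaps-miss (idPerm n) u asc-u dist-c′ β<γ β-before-γ)
                                  (swaps-miss (idPerm n) u asc-u dist-c′ α<β α-before-β)

mainTheorem9 : (n : ℕ) → 2 ≤ n → (w : List ℕ) → IsPerm n w →
    (a : List ℕ) → Reduced n w a → ¬ SameClass (amin w) a →
    ∃[ b ] (Reduced n w b
      × (∃[ a′ ] ∃[ b′ ] (SameClass a a′ × SameClass b b′ × LongBraid a′ b′))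
      × (∀ τ → InSup n w b τ → InSup n w a τ)
      × (∃[ τ ] (InSup n w a τ × ¬ InSup n w b τ)))
mainTheorem9 n _ w _ a red a∉[amin] with amin-or-braid (length a) n a ≤-refl (reduced⇒ascending red)
... | inj₁ amin~a = ⊥-elim (a∉[amin] (subst (λ v → SameClass (amin v) a) (proj₂ (proj₂ red)) amin~a))
... | inj₂ (_ , a~a′ , u , v , i , refl) =
  u ++ i ∷ suc i ∷ i ∷ v , Reduced-braid u v i red′ ,
  (_ , _ , a~a′ , ε , u , v , i , inj₂ (refl , refl)) ,
  (λ τ → back τ ∘′ proj₁ shrink τ) ,
  (proj₁ (proj₂ shrink) , back _ (proj₁ (proj₂ (proj₂ shrink))) , proj₂ (proj₂ (proj₂ shrink)))
  where
  red′ = Reduced-SameClass a~a′ red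
  shrink = braid-shrinks-sup n w u v i red′
  back = InSup-SameClass n w (reduced⇒ascending red′) (SameClass-sym a~a′)
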